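{- Let $t$ be an arbor and let $M_t(X,Y)$ be the $M$-triangle of the poset $P_t$. Then the transmuted $M$-triangle $\overline{M}_t(X,Y)=M_t\!\left(\frac{1-Y}{1-XY},\,1-XY\right)$ is a polynomial in $X,Y$, and for every $k\ge0$ the coefficient of $X^kY^k$ in $\overline{M}_t$ equals the number of elements $b\in P_t$ with $\mathrm{nz}(b)=k$; i.e. the diagonal of $\overline{M}_t$ is the $h$-vector $h_t(X)=\sum_{b\in P_t}X^{\mathrm{nz}(b)}$.
   Context: An arbor on a finite non-empty set $I$ is a rooted tree whose vertices are labeled by pairwise disjoint non-empty subsets of $I$ whose union is $I$; we identify a vertex with its label set. For a vertex $v$, $\mathscr{D}(v)$ is the union of the labels of all vertices whose path to the root passes through $v$ (including $v$). The poset $P_t$ is the set of $a\in\mathbb{Z}^I$ with $a_i\ge0$ and $\sum_{i\in\mathscr{D}(v)}a_i\le|\mathscr{D}(v)|$ for every vertex $v$, ordered coordinate-wise; it is graded by $\mathrm{ht}(a)=\sum_ia_i$, and $\mathrm{nz}(a)$ denotes the number of non-zero coordinates. The $M$-triangle of a graded poset $P$ with rank function $\mathrm{ht}$ and Möbius function $\mu$ is $M(X,Y)=\sum_{a\le b}\mu(a,b)X^{\mathrm{ht}(a)}Y^{\mathrm{ht}(b)}$. -}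

module Defs where

open import Data.Bool using (Bool; true; false; _∧_; if_then_else_; not)
open import Data.Nat as ℕ using (ℕ; zero; suc; _∸_; _≤ᵇ_; _≡ᵇ_)
open import Data.Integer as ℤ using (ℤ; +_; -_; 0ℤ; 1ℤ)
open import Data.Fin using (Fin)
open import Data.List as List using (List; []; _∷_; _++_; length; concat; filter; allFin)
open import Data.List.Relation.Unary.All using (All)
open import Data.List.Relation.Binary.Permutation.Propositional using (_↭_)
open import Data.Vec as Vec using (Vec; []; _∷_; lookup; toList)
open import Data.Product using (_×_; _,_)
open import Relation.Nullary using (¬_)
open import Relation.Binary.PropositionalEquality using (_≡_)
open import Function using (_∘_)
open import Data.Nat.ListAction using () renaming (sum to sumℕ)

data Tree (A : Set) : Set where
  node : A → List (Tree A) → Tree A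

mutual
  labels : ∀ {A} → Tree A → List A
  labels (node x ts) = x ∷ labelsF ts

  labelsF : ∀ {A} → List (Tree A) → List A
  labelsF []       = []
  labelsF (t ∷ ts) = labels t ++ labelsF ts

𝒟 : ∀ {n} → Tree (List (Fin n)) → List (Fin n)
𝒟 t = concat (labels t)

mutual
  downsets : ∀ {n} → Tree (List (Fin n)) → List (List (Fin n))
  downsets t@(node x ts) = 𝒟 t ∷ downsetsF ts

  downsetsF : ∀ {n} → List (Tree (List (Fin n))) → List (List (Fin n))
  downsetsF []       = []
  downsetsF (t ∷ ts) = downsets t ++ downsetsF ts

-- A tree labelled by subsets of Fin n is an arbor on Fin n iff every
-- label is non-empty and the labels are pairwise disjoint with union
-- Fin n (i.e. the concatenation of the labels is a permutation of
-- the list of all elements of Fin n).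
IsArbor : (n : ℕ) → Tree (List (Fin n)) → Set
IsArbor n t = All (λ l → ¬ (l ≡ [])) (labels t) × (concat (labels t) ↭ allFin n)

sumOver : ∀ {n} → Vec ℕ n → List (Fin n) → ℕ
sumOver a D = sumℕ (List.map (lookup a) D)

allᵇ : ∀ {A : Set} → (A → Bool) → List A → Bool
allᵇ p []       = true
allᵇ p (x ∷ xs) = p x ∧ allᵇ p xs

inPᵇ : ∀ {n} → Tree (List (Fin n)) → Vec ℕ n → Bool
inPᵇ t a = allᵇ (λ D → sumOver a D ≤ᵇ length D) (downsets t)

box : (m n : ℕ) → List (Vec ℕ n)
box m zero    = [] ∷ []
box m (suc n) = concat (List.map (λ x → List.map (x ∷_) (box m n)) (List.upTo (suc m)))

countᵇ : ∀ {A : Set} → (A → Bool) → List A → ℕ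
countᵇ p []       = 0
countᵇ p (x ∷ xs) = if p x then suc (countᵇ p xs) else countᵇ p xs

filterᵇ : ∀ {A : Set} → (A → Bool) → List A → List A
filterᵇ p []       = []
filterᵇ p (x ∷ xs) = if p x then x ∷ filterᵇ p xs else filterᵇ p xs

-- the elements of P_t.  Every a ∈ P_t has a_i ≤ n (root constraint,
-- 𝒟(root) = I), so P_t is exactly the filtered box {0..n}^n.
Pt : ∀ {n} → Tree (List (Fin n)) → List (Vec ℕ n)
Pt {n} t = filterᵇ (inPᵇ t) (box n n)

_≤ⱽ_ : ∀ {n} → Vec ℕ n → Vec ℕ n → Bool
[]       ≤ⱽ []       = true
(x ∷ xs) ≤ⱽ (y ∷ ys) = (x ≤ᵇ y) ∧ (xs ≤ⱽ ys)

_==ⱽ_ : ∀ {n} → Vec ℕ n → Vec ℕ n → Bool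
[]       ==ⱽ []       = true
(x ∷ xs) ==ⱽ (y ∷ ys) = (x ≡ᵇ y) ∧ (xs ==ⱽ ys)

ht : ∀ {n} → Vec ℕ n → ℕ
ht a = sumℕ (toList a)

nz : ∀ {n} → Vec ℕ n → ℕ
nz a = countᵇ (λ x → not (x ≡ᵇ 0)) (toList a)

-- The fuel argument bounds the recursion depth; fuel = length L suffices
-- since every chain in L has at most length L elements.

sumℤ : List ℤ → ℤ
sumℤ = List.foldr ℤ._+_ 0ℤ

mobiusF : ∀ {n} → List (Vec ℕ n) → ℕ → Vec ℕ n → Vec ℕ n → ℤ
mobiusF L fuel a b =
  if a ≤ⱽ b then
    (if a ==ⱽ b then 1ℤ else
      (case fuel of λ { zero → 0ℤ
                      ; (suc f) → - sumℤ (List.map (λ c → mobiusF L f a c)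
                                     (filterᵇ (λ c → (a ≤ⱽ c) ∧ (c ≤ⱽ b) ∧ not (c ==ⱽ b)) L)) }))
  else 0ℤ
  where open import Function using (case_of_)

μ : ∀ {n} → Tree (List (Fin n)) → Vec ℕ n → Vec ℕ n → ℤ
μ t = mobiusF (Pt t) (length (Pt t))

-- Formal power series in X, Y over ℤ: coefficient functions ℕ → ℕ → ℤ
-- (coefficient of X^i Y^j).  Polynomials are those with finite support.

PS : Set
PS = ℕ → ℕ → ℤ

sumUpTo : ℕ → (ℕ → ℤ) → ℤ
sumUpTo zero    f = f 0
sumUpTo (suc m) f = sumUpTo m f ℤ.+ f (suc m)

_⊛_ : PS → PS → PS
(p ⊛ q) i j = sumUpTo i (λ a → sumUpTo j (λ b → p a b ℤ.* q (i ∸ a) (j ∸ b)))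

_⊕_ : PS → PS → PS
(p ⊕ q) i j = p i j ℤ.+ q i j

_·_ : ℤ → PS → PS
(c · p) i j = c ℤ.* p i j

zeroPS : PS
zeroPS i j = 0ℤ

onePS : PS
onePS zero zero = 1ℤ
onePS _    _    = 0ℤ

_^ᴾ_ : PS → ℕ → PS
p ^ᴾ zero  = onePS
p ^ᴾ suc k = p ⊛ (p ^ᴾ k)

oneMinusY : PS
oneMinusY zero zero       = 1ℤ
oneMinusY zero (suc zero) = - 1ℤ
oneMinusY _    _          = 0ℤ

oneMinusXY : PS
oneMinusXY zero zero             = 1ℤ
oneMinusXY (suc zero) (suc zero) = - 1ℤ
oneMinusXY _    _                = 0ℤ

-- (1 - XY)^{-1} = Σ_k X^k Y^k  (inverse of oneMinusXY in ℤ[[X,Y]])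
invOneMinusXY : PS
invOneMinusXY i j = if i ≡ᵇ j then 1ℤ else 0ℤ

-- the image of the monomial X^i Y^j under X ↦ (1-Y)/(1-XY), Y ↦ 1-XY
substMono : ℕ → ℕ → PS
substMono i j = (oneMinusY ^ᴾ i) ⊛ ((invOneMinusXY ^ᴾ i) ⊛ (oneMinusXY ^ᴾ j))

-- M-triangle of P_t as a formal sum of terms  μ(a,b) X^{ht a} Y^{ht b}
-- over pairs a ≤ b in P_t, and its transmutation.

Mterms : ∀ {n} → Tree (List (Fin n)) → List (ℤ × ℕ × ℕ)
Mterms t = concat (List.map (λ a → List.map (λ b → (μ t a b , ht a , ht b))
                                (filterᵇ (λ b → a ≤ⱽ b) (Pt t))) (Pt t))

Mtri : ∀ {n} → Tree (List (Fin n)) → PS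
Mtri t = List.foldr (λ { (c , i , j) acc → (c · monomial i j) ⊕ acc }) zeroPS (Mterms t)
  where
    monomial : ℕ → ℕ → PS
    monomial i j k l = if (i ≡ᵇ k) ∧ (j ≡ᵇ l) then 1ℤ else 0ℤ

Mbar : ∀ {n} → Tree (List (Fin n)) → PS
Mbar t = List.foldr (λ { (c , i , j) acc → (c · substMono i j) ⊕ acc }) zeroPS (Mterms t)

hcoeff : ∀ {n} → Tree (List (Fin n)) → ℕ → ℕ
hcoeff t k = countᵇ (λ b → nz b ≡ᵇ k) (Pt t)

-- P_t is a lower set of the box {0..n}ⁿ, so each interval [a, b] of P_t is an interval of ℕⁿ and its
-- Möbius function is the product μ(a, b) = ∏ᵢ μℕ(aᵢ, bᵢ), where μℕ(x, x) = 1, μℕ(x, x + 1) = -1 and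
-- μℕ vanishes otherwise. Under the substitution the factor (1 - XY)⁻¹ cancels, and the term
-- μ(a, b) X^ht(a) Y^ht(b) becomes μ(a, b) (1 - Y)^ht(a) (1 - XY)^(ht(b) - ht(a)). Hence for fixed b the
-- sum over a factors over the coordinates: bᵢ = 0 contributes 1 and bᵢ = y + 1 contributes
-- (1 - Y)^y (XY - Y). This product has X-degree at most nz(b), Y-degrees between nz(b) and ht(b), and
-- coefficient 1 at X^nz(b) Y^nz(b); summing over b ∈ P_t gives both claims.

module Submission where

open import Defs
open import Data.Nat using (ℕ; _<_)
open import Data.Integer using (+_; 0ℤ)
open import Data.Fin using (Fin)
open import Data.List using (List)
open import Data.Product using (Σ; _×_)
open import Data.Sum using (_⊎_)
open import Relation.Binary.PropositionalEquality using (_≡_)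

open import Data.Bool using (Bool; true; false; if_then_else_; _∧_; not; T)
open import Data.Bool.Properties using (T-∧; T?)
import Data.Fin as Fin
open import Data.Integer as ℤ using (ℤ; -_; 1ℤ; _+_; _*_)
import Data.Integer.Properties as ℤ
open import Algebra.Properties.AbelianGroup ℤ.+-0-abelianGroup using (inverseʳ-unique)
open import Algebra.Properties.CommutativeSemigroup ℤ.+-commutativeSemigroup using (interchange)
open import Data.List using ([]; _∷_; _++_; concat; applyUpTo)
import Data.List as List
open import Data.Nat as ℕ using (zero; suc; _∸_; _≤_; z≤n; s≤s)
import Data.Nat.Properties as ℕ
open import Data.Product using (_,_; proj₁; proj₂)
open import Data.Sum using (inj₁; inj₂)
open import Data.Vec using (Vec; []; _∷_; lookup)
open import Data.Vec.Relation.Unary.All using (All; []; _∷_)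
open import Function using (_∘_)
open import Function.Bundles using (module Equivalence)
open import Relation.Binary.Bundles using (Setoid)
open import Relation.Binary.Definitions using (tri<; tri≈; tri>)
open import Relation.Binary.PropositionalEquality
  using (_≢_; refl; sym; trans; cong; cong₂; module ≡-Reasoning)
import Relation.Binary.Reasoning.Setoid as SetoidReasoning
open import Relation.Nullary using (¬_; contradiction; yes; no)
open import Relation.Nullary.Decidable using (decidable-stable)

sumUpTo-cong : ∀ n {f g : ℕ → ℤ} → (∀ a → a ≤ n → f a ≡ g a) → sumUpTo n f ≡ sumUpTo n g
sumUpTo-cong zero    f≗g = f≗g 0 z≤n
sumUpTo-cong (suc n) f≗g = cong₂ _+_ (sumUpTo-cong n (λ a a≤n → f≗g a (ℕ.m≤n⇒m≤1+n a≤n))) (f≗g (suc n) ℕ.≤-refl)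

sumUpTo-+ : ∀ n (f g : ℕ → ℤ) → sumUpTo n (λ a → f a + g a) ≡ sumUpTo n f + sumUpTo n g
sumUpTo-+ zero    f g = refl
sumUpTo-+ (suc n) f g rewrite sumUpTo-+ n f g = interchange (sumUpTo n f) (sumUpTo n g) (f (suc n)) (g (suc n))

sumUpTo-*ˡ : ∀ n c (f : ℕ → ℤ) → c * sumUpTo n f ≡ sumUpTo n (λ a → c * f a)
sumUpTo-*ˡ zero    c f = refl
sumUpTo-*ˡ (suc n) c f rewrite ℤ.*-distribˡ-+ c (sumUpTo n f) (f (suc n)) | sumUpTo-*ˡ n c f = refl

sumUpTo-*ʳ : ∀ n c (f : ℕ → ℤ) → sumUpTo n f * c ≡ sumUpTo n (λ a → f a * c)
sumUpTo-*ʳ n c f = trans (ℤ.*-comm _ c) (trans (sumUpTo-*ˡ n c f) (sumUpTo-cong n (λ a _ → ℤ.*-comm c (f a))))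

sumUpTo-zero : ∀ n {f : ℕ → ℤ} → (∀ a → a ≤ n → f a ≡ 0ℤ) → sumUpTo n f ≡ 0ℤ
sumUpTo-zero zero    f≡0 = f≡0 0 z≤n
sumUpTo-zero (suc n) f≡0
  rewrite sumUpTo-zero n (λ a a≤n → f≡0 a (ℕ.m≤n⇒m≤1+n a≤n)) | f≡0 (suc n) ℕ.≤-refl = refl

sumUpTo-single : ∀ n k {f : ℕ → ℤ} → k ≤ n → (∀ a → a ≤ n → a ≢ k → f a ≡ 0ℤ) → sumUpTo n f ≡ f k
sumUpTo-single zero    .zero z≤n _ = refl
sumUpTo-single (suc n) k {f} k≤1+n f≡0 with ℕ.m≤n⇒m<n∨m≡n k≤1+n
... | inj₂ refl = trans (cong (_+ f (suc n)) (sumUpTo-zero n below)) (ℤ.+-identityˡ _)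
  where
  below : ∀ a → a ≤ n → f a ≡ 0ℤ
  below a a≤n = f≡0 a (ℕ.m≤n⇒m≤1+n a≤n) (ℕ.<⇒≢ (s≤s a≤n))
... | inj₁ (s≤s k≤n) =
  trans (cong₂ _+_ (sumUpTo-single n k k≤n (λ a a≤n → f≡0 a (ℕ.m≤n⇒m≤1+n a≤n)))
                   (f≡0 (suc n) ℕ.≤-refl (ℕ.<⇒≢ (s≤s k≤n) ∘ sym)))
        (ℤ.+-identityʳ _)

sumUpTo-pair : ∀ n k {f : ℕ → ℤ} → suc k ≤ n → (∀ a → a ≤ n → a ≢ k → a ≢ suc k → f a ≡ 0ℤ) →
               sumUpTo n f ≡ f k + f (suc k)
sumUpTo-pair (suc n) k {f} (s≤s k≤n) f≡0 with ℕ.m≤n⇒m<n∨m≡n k≤n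
... | inj₂ refl = cong (_+ f (suc k)) (sumUpTo-single k k ℕ.≤-refl below)
  where
  below : ∀ a → a ≤ k → a ≢ k → f a ≡ 0ℤ
  below a a≤k a≢k = f≡0 a (ℕ.m≤n⇒m≤1+n a≤k) a≢k (ℕ.<⇒≢ (s≤s a≤k))
... | inj₁ k<n =
  trans (cong₂ _+_ (sumUpTo-pair n k k<n (λ a a≤n → f≡0 a (ℕ.m≤n⇒m≤1+n a≤n)))
                   (f≡0 (suc n) ℕ.≤-refl (ℕ.<⇒≢ (ℕ.m<n⇒m<1+n k<n) ∘ sym) (ℕ.<⇒≢ k<n ∘ sym ∘ ℕ.suc-injective)))
        (ℤ.+-identityʳ _)

sumUpTo-truncate : ∀ n k {f g : ℕ → ℤ} → k ≤ n → (∀ a → a ≤ k → f a ≡ g a) → (∀ a → k < a → f a ≡ 0ℤ) →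
                   sumUpTo n f ≡ sumUpTo k g
sumUpTo-truncate n k k≤n f≗g f≡0 with ℕ.m≤n⇒m<n∨m≡n k≤n
sumUpTo-truncate n       k k≤n f≗g f≡0 | inj₂ refl = sumUpTo-cong k f≗g
sumUpTo-truncate (suc n) k k≤n f≗g f≡0 | inj₁ (s≤s k≤n') =
  trans (cong₂ _+_ (sumUpTo-truncate n k k≤n' f≗g f≡0) (f≡0 (suc n) (s≤s k≤n'))) (ℤ.+-identityʳ _)

sumUpTo-suc : ∀ n (f : ℕ → ℤ) → sumUpTo (suc n) f ≡ f 0 + sumUpTo n (f ∘ suc)
sumUpTo-suc zero    f = refl
sumUpTo-suc (suc n) f rewrite sumUpTo-suc n f = ℤ.+-assoc (f 0) _ _

sumUpTo-reverse : ∀ n (f : ℕ → ℤ) → sumUpTo n (λ a → f (n ∸ a)) ≡ sumUpTo n f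
sumUpTo-reverse zero    f = refl
sumUpTo-reverse (suc n) f = begin
  sumUpTo n (λ a → f (suc n ∸ a)) + f (n ∸ n)
    ≡⟨ cong₂ _+_ (sumUpTo-cong n (λ a a≤n → cong f (ℕ.+-∸-assoc 1 a≤n))) (cong f (ℕ.n∸n≡0 n)) ⟩
  sumUpTo n (λ a → f (suc (n ∸ a))) + f 0
    ≡⟨ cong (_+ f 0) (sumUpTo-reverse n (f ∘ suc)) ⟩
  sumUpTo n (f ∘ suc) + f 0
    ≡⟨ ℤ.+-comm _ (f 0) ⟩
  f 0 + sumUpTo n (f ∘ suc)
    ≡⟨ sumUpTo-suc n f ⟨
  sumUpTo (suc n) f ∎
  where open ≡-Reasoning

sumUpTo-swap : ∀ m n (F : ℕ → ℕ → ℤ) →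
               sumUpTo m (λ a → sumUpTo n (F a)) ≡ sumUpTo n (λ b → sumUpTo m (λ a → F a b))
sumUpTo-swap zero    n F = refl
sumUpTo-swap (suc m) n F rewrite sumUpTo-swap m n F = sym (sumUpTo-+ n _ _)

sumUpTo-triangle : ∀ n (K : ℕ → ℕ → ℤ) →
  sumUpTo n (λ a → sumUpTo a (λ c → K c a)) ≡ sumUpTo n (λ c → sumUpTo (n ∸ c) (λ e → K c (c ℕ.+ e)))
sumUpTo-triangle zero    K = refl
sumUpTo-triangle (suc n) K = begin
  sumUpTo n (λ a → sumUpTo a (λ c → K c a)) + (sumUpTo n (λ c → K c (suc n)) + K (suc n) (suc n))
    ≡⟨ cong (_+ (sumUpTo n (λ c → K c (suc n)) + K (suc n) (suc n))) (sumUpTo-triangle n K) ⟩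
  R + (sumUpTo n (λ c → K c (suc n)) + K (suc n) (suc n))
    ≡⟨ ℤ.+-assoc R _ _ ⟨
  (R + sumUpTo n (λ c → K c (suc n))) + K (suc n) (suc n)
    ≡⟨ cong₂ _+_ (sumUpTo-+ n _ _) corner ⟨
  sumUpTo n (λ c → sumUpTo (n ∸ c) (λ e → K c (c ℕ.+ e)) + K c (suc n)) + D
    ≡⟨ cong (_+ D) (sumUpTo-cong n extend) ⟩
  sumUpTo n (λ c → sumUpTo (suc n ∸ c) (λ e → K c (c ℕ.+ e))) + D ∎
  where
  open ≡-Reasoning
  R : ℤ
  R = sumUpTo n (λ c → sumUpTo (n ∸ c) (λ e → K c (c ℕ.+ e)))
  D : ℤ
  D = sumUpTo (n ∸ n) (λ e → K (suc n) (suc n ℕ.+ e))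
  corner : D ≡ K (suc n) (suc n)
  corner rewrite ℕ.n∸n≡0 n | ℕ.+-identityʳ n = refl
  extend : ∀ c → c ≤ n → sumUpTo (n ∸ c) (λ e → K c (c ℕ.+ e)) + K c (suc n) ≡ sumUpTo (suc n ∸ c) (λ e → K c (c ℕ.+ e))
  extend c c≤n rewrite ℕ.+-∸-assoc 1 c≤n =
    cong (λ x → sumUpTo (n ∸ c) (λ e → K c (c ℕ.+ e)) + K c x) (sym (trans (ℕ.+-suc c (n ∸ c)) (cong suc (ℕ.m+[n∸m]≡n c≤n))))

infix 4 _≗₂_
_≗₂_ : PS → PS → Set
p ≗₂ q = ∀ i j → p i j ≡ q i j

PS-setoid : Setoid _ _
PS-setoid = record
  { Carrier       = PS
  ; _≈_           = _≗₂_
  ; isEquivalence = record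
    { refl  = λ i j → refl
    ; sym   = λ p≗q i j → sym (p≗q i j)
    ; trans = λ p≗q q≗r i j → trans (p≗q i j) (q≗r i j)
    }
  }

open Setoid PS-setoid public using () renaming (refl to ≗₂-refl; sym to ≗₂-sym; trans to ≗₂-trans)

≡⇒≗₂ : ∀ {p q} → p ≡ q → p ≗₂ q
≡⇒≗₂ refl = ≗₂-refl

⊛-cong : ∀ {p p′ q q′} → p ≗₂ p′ → q ≗₂ q′ → (p ⊛ q) ≗₂ (p′ ⊛ q′)
⊛-cong p≗p′ q≗q′ i j =
  sumUpTo-cong i (λ a _ → sumUpTo-cong j (λ b _ → cong₂ _*_ (p≗p′ a b) (q≗q′ (i ∸ a) (j ∸ b))))

⊛-congˡ : ∀ {p p′} q → p ≗₂ p′ → (p ⊛ q) ≗₂ (p′ ⊛ q)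
⊛-congˡ q p≗p′ = ⊛-cong p≗p′ (≗₂-refl {q})

⊛-congʳ : ∀ p {q q′} → q ≗₂ q′ → (p ⊛ q) ≗₂ (p ⊛ q′)
⊛-congʳ p q≗q′ = ⊛-cong (≗₂-refl {p}) q≗q′

⊛-comm : ∀ p q → (p ⊛ q) ≗₂ (q ⊛ p)
⊛-comm p q i j = begin
  sumUpTo i (λ a → sumUpTo j (λ b → p a b * q (i ∸ a) (j ∸ b)))
    ≡⟨ sumUpTo-reverse i _ ⟨
  sumUpTo i (λ a → sumUpTo j (λ b → p (i ∸ a) b * q (i ∸ (i ∸ a)) (j ∸ b)))
    ≡⟨ sumUpTo-cong i (λ a _ → sym (sumUpTo-reverse j _)) ⟩
  sumUpTo i (λ a → sumUpTo j (λ b → p (i ∸ a) (j ∸ b) * q (i ∸ (i ∸ a)) (j ∸ (j ∸ b))))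
    ≡⟨ sumUpTo-cong i (λ a a≤i → sumUpTo-cong j (λ b b≤j →
         trans (cong₂ (λ x y → p (i ∸ a) (j ∸ b) * q x y) (ℕ.m∸[m∸n]≡n a≤i) (ℕ.m∸[m∸n]≡n b≤j))
               (ℤ.*-comm (p (i ∸ a) (j ∸ b)) (q a b)))) ⟩
  sumUpTo i (λ a → sumUpTo j (λ b → q a b * p (i ∸ a) (j ∸ b))) ∎
  where open ≡-Reasoning

⊛-assoc : ∀ p q r → ((p ⊛ q) ⊛ r) ≗₂ (p ⊛ (q ⊛ r))
⊛-assoc p q r i j = begin
  sumUpTo i (λ a → sumUpTo j (λ b → sumUpTo a (λ c → sumUpTo b (λ d → p c d * q (a ∸ c) (b ∸ d))) * r (i ∸ a) (j ∸ b)))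
    ≡⟨ sumUpTo-cong i (λ a _ → sumUpTo-cong j (λ b _ → trans (sumUpTo-*ʳ a _ _) (sumUpTo-cong a (λ c _ → sumUpTo-*ʳ b _ _)))) ⟩
  sumUpTo i (λ a → sumUpTo j (λ b → sumUpTo a (λ c → sumUpTo b (λ d → (p c d * q (a ∸ c) (b ∸ d)) * r (i ∸ a) (j ∸ b)))))
    ≡⟨ sumUpTo-cong i (λ a _ → sumUpTo-swap j a _) ⟩
  sumUpTo i (λ a → sumUpTo a (λ c → sumUpTo j (λ b → sumUpTo b (λ d → (p c d * q (a ∸ c) (b ∸ d)) * r (i ∸ a) (j ∸ b)))))
    ≡⟨ sumUpTo-triangle i _ ⟩
  sumUpTo i (λ c → sumUpTo (i ∸ c) (λ e → sumUpTo j (λ b → sumUpTo b (λ d →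
    (p c d * q ((c ℕ.+ e) ∸ c) (b ∸ d)) * r (i ∸ (c ℕ.+ e)) (j ∸ b)))))
    ≡⟨ sumUpTo-cong i (λ c _ → sumUpTo-cong (i ∸ c) (λ e _ → sumUpTo-cong j (λ b _ → sumUpTo-cong b (λ d _ →
         cong₂ (λ x y → (p c d * q x (b ∸ d)) * r y (j ∸ b)) (ℕ.m+n∸m≡n c e) (sym (ℕ.∸-+-assoc i c e)))))) ⟩
  sumUpTo i (λ c → sumUpTo (i ∸ c) (λ e → sumUpTo j (λ b → sumUpTo b (λ d → (p c d * q e (b ∸ d)) * r (i ∸ c ∸ e) (j ∸ b)))))
    ≡⟨ sumUpTo-cong i (λ c _ → sumUpTo-cong (i ∸ c) (λ e _ → sumUpTo-triangle j _)) ⟩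
  sumUpTo i (λ c → sumUpTo (i ∸ c) (λ e → sumUpTo j (λ d → sumUpTo (j ∸ d) (λ f →
    (p c d * q e ((d ℕ.+ f) ∸ d)) * r (i ∸ c ∸ e) (j ∸ (d ℕ.+ f))))))
    ≡⟨ sumUpTo-cong i (λ c _ → sumUpTo-cong (i ∸ c) (λ e _ → sumUpTo-cong j (λ d _ → sumUpTo-cong (j ∸ d) (λ f _ →
         trans (cong₂ (λ x y → (p c d * q e x) * r (i ∸ c ∸ e) y) (ℕ.m+n∸m≡n d f) (sym (ℕ.∸-+-assoc j d f)))
               (ℤ.*-assoc (p c d) _ _))))) ⟩
  sumUpTo i (λ c → sumUpTo (i ∸ c) (λ e → sumUpTo j (λ d → sumUpTo (j ∸ d) (λ f → p c d * (q e f * r (i ∸ c ∸ e) (j ∸ d ∸ f))))))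
    ≡⟨ sumUpTo-cong i (λ c _ → sumUpTo-swap j (i ∸ c) _) ⟨
  sumUpTo i (λ c → sumUpTo j (λ d → sumUpTo (i ∸ c) (λ e → sumUpTo (j ∸ d) (λ f → p c d * (q e f * r (i ∸ c ∸ e) (j ∸ d ∸ f))))))
    ≡⟨ sumUpTo-cong i (λ c _ → sumUpTo-cong j (λ d _ →
         trans (sumUpTo-*ˡ (i ∸ c) (p c d) _) (sumUpTo-cong (i ∸ c) (λ e _ → sumUpTo-*ˡ (j ∸ d) (p c d) _)))) ⟨
  sumUpTo i (λ c → sumUpTo j (λ d → p c d * sumUpTo (i ∸ c) (λ e → sumUpTo (j ∸ d) (λ f → q e f * r (i ∸ c ∸ e) (j ∸ d ∸ f))))) ∎
  where open ≡-Reasoning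

⊛-distribˡ-⊕ : ∀ p q r → (p ⊛ (q ⊕ r)) ≗₂ ((p ⊛ q) ⊕ (p ⊛ r))
⊛-distribˡ-⊕ p q r i j =
  trans (sumUpTo-cong i (λ a _ → trans (sumUpTo-cong j (λ b _ → ℤ.*-distribˡ-+ (p a b) _ _)) (sumUpTo-+ j _ _)))
        (sumUpTo-+ i _ _)

⊛-scaleˡ : ∀ c p q → ((c · p) ⊛ q) ≗₂ (c · (p ⊛ q))
⊛-scaleˡ c p q i j = sym (trans (sumUpTo-*ˡ i c _)
  (sumUpTo-cong i (λ a _ → trans (sumUpTo-*ˡ j c _) (sumUpTo-cong j (λ b _ → sym (ℤ.*-assoc c _ _))))))

⊛-scaleʳ : ∀ c p q → (p ⊛ (c · q)) ≗₂ (c · (p ⊛ q))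
⊛-scaleʳ c p q i j = trans (⊛-comm p (c · q) i j) (trans (⊛-scaleˡ c q p i j) (cong (c *_) (⊛-comm q p i j)))

⊛-identityˡ : ∀ q → (onePS ⊛ q) ≗₂ q
⊛-identityˡ q i j =
  trans (sumUpTo-single i 0 z≤n outer) (trans (sumUpTo-single j 0 z≤n inner) (ℤ.*-identityˡ _))
  where
  outer : ∀ a → a ≤ i → a ≢ 0 → sumUpTo j (λ b → onePS a b * q (i ∸ a) (j ∸ b)) ≡ 0ℤ
  outer zero    _ a≢0 = contradiction refl a≢0
  outer (suc a) _ _   = sumUpTo-zero j (λ _ _ → refl)
  inner : ∀ b → b ≤ j → b ≢ 0 → onePS 0 b * q i (j ∸ b) ≡ 0ℤ
  inner zero    _ b≢0 = contradiction refl b≢0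
  inner (suc b) _ _   = refl

⊛-identityʳ : ∀ q → (q ⊛ onePS) ≗₂ q
⊛-identityʳ q = ≗₂-trans (⊛-comm q onePS) (⊛-identityˡ q)

⊛-interchange : ∀ p q r s → ((p ⊛ q) ⊛ (r ⊛ s)) ≗₂ ((p ⊛ r) ⊛ (q ⊛ s))
⊛-interchange p q r s = begin
  (p ⊛ q) ⊛ (r ⊛ s) ≈⟨ ⊛-assoc p q (r ⊛ s) ⟩
  p ⊛ (q ⊛ (r ⊛ s)) ≈⟨ ⊛-congʳ p (⊛-assoc q r s) ⟨
  p ⊛ ((q ⊛ r) ⊛ s) ≈⟨ ⊛-congʳ p (⊛-congˡ s (⊛-comm q r)) ⟩
  p ⊛ ((r ⊛ q) ⊛ s) ≈⟨ ⊛-congʳ p (⊛-assoc r q s) ⟩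
  p ⊛ (r ⊛ (q ⊛ s)) ≈⟨ ⊛-assoc p r (q ⊛ s) ⟨
  (p ⊛ r) ⊛ (q ⊛ s) ∎
  where open SetoidReasoning PS-setoid

^ᴾ-cong : ∀ {p q} k → p ≗₂ q → (p ^ᴾ k) ≗₂ (q ^ᴾ k)
^ᴾ-cong zero    p≗q = ≗₂-refl
^ᴾ-cong (suc k) p≗q = ⊛-cong p≗q (^ᴾ-cong k p≗q)

^ᴾ-distribˡ-+-⊛ : ∀ p k l → (p ^ᴾ (k ℕ.+ l)) ≗₂ ((p ^ᴾ k) ⊛ (p ^ᴾ l))
^ᴾ-distribˡ-+-⊛ p zero    l = ≗₂-sym (⊛-identityˡ (p ^ᴾ l))
^ᴾ-distribˡ-+-⊛ p (suc k) l =
  ≗₂-trans (⊛-congʳ p (^ᴾ-distribˡ-+-⊛ p k l)) (≗₂-sym (⊛-assoc p (p ^ᴾ k) (p ^ᴾ l)))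

^ᴾ-distribʳ-⊛ : ∀ p q k → ((p ⊛ q) ^ᴾ k) ≗₂ ((p ^ᴾ k) ⊛ (q ^ᴾ k))
^ᴾ-distribʳ-⊛ p q zero    = ≗₂-sym (⊛-identityˡ onePS)
^ᴾ-distribʳ-⊛ p q (suc k) = ≗₂-trans (⊛-congʳ (p ⊛ q) (^ᴾ-distribʳ-⊛ p q k)) (⊛-interchange p q (p ^ᴾ k) (q ^ᴾ k))

onePS-^ᴾ : ∀ k → (onePS ^ᴾ k) ≗₂ onePS
onePS-^ᴾ zero    = ≗₂-refl
onePS-^ᴾ (suc k) = ≗₂-trans (⊛-congʳ onePS (onePS-^ᴾ k)) (⊛-identityˡ onePS)

-- Simplifying the substitution X ↦ (1 - Y)/(1 - XY), Y ↦ 1 - XY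

oneMinusXY-row₀ : ∀ j (g : ℕ → ℤ) → sumUpTo j (λ b → oneMinusXY 0 b * g (j ∸ b)) ≡ g j
oneMinusXY-row₀ j g =
  trans (sumUpTo-single j 0 z≤n (λ { zero _ b≢0 → contradiction refl b≢0 ; (suc b) _ _ → refl }))
        (ℤ.*-identityˡ _)

oneMinusXY-⊛-zero : ∀ f j → (oneMinusXY ⊛ f) 0 j ≡ f 0 j
oneMinusXY-⊛-zero f j = oneMinusXY-row₀ j (f 0)

oneMinusXY-⊛-suc-zero : ∀ f i → (oneMinusXY ⊛ f) (suc i) 0 ≡ f (suc i) 0
oneMinusXY-⊛-suc-zero f i =
  trans (sumUpTo-suc i _)
        (trans (cong₂ _+_ (ℤ.*-identityˡ (f (suc i) 0)) (sumUpTo-zero i (λ { zero _ → refl ; (suc a) _ → refl })))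
               (ℤ.+-identityʳ (f (suc i) 0)))

oneMinusXY-⊛-suc-suc : ∀ f i j → (oneMinusXY ⊛ f) (suc i) (suc j) ≡ f (suc i) (suc j) + - f i j
oneMinusXY-⊛-suc-suc f i j = begin
  sumUpTo (suc i) row            ≡⟨ sumUpTo-suc i row ⟩
  row 0 + sumUpTo i (row ∘ suc)  ≡⟨ cong₂ _+_ (oneMinusXY-row₀ (suc j) (f (suc i))) (sumUpTo-single i 0 z≤n row≡0) ⟩
  f (suc i) (suc j) + row 1      ≡⟨ cong₂ _+_ (refl {x = f (suc i) (suc j)}) row1 ⟩
  f (suc i) (suc j) + - f i j    ∎
  where
  open ≡-Reasoning
  row : ℕ → ℤ
  row a = sumUpTo (suc j) (λ b → oneMinusXY a b * f (suc i ∸ a) (suc j ∸ b))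
  row≡0 : ∀ a → a ≤ i → a ≢ 0 → row (suc a) ≡ 0ℤ
  row≡0 zero    _ a≢0 = contradiction refl a≢0
  row≡0 (suc a) _ _   = sumUpTo-zero (suc j) (λ _ _ → refl)
  row1 : row 1 ≡ - f i j
  row1 = trans (sumUpTo-suc j _) (trans (ℤ.+-identityˡ _)
    (trans (sumUpTo-single j 0 z≤n (λ { zero _ b≢0 → contradiction refl b≢0 ; (suc b) _ _ → refl }))
           (ℤ.-1*i≡-i _)))

invOneMinusXY-inverse : (invOneMinusXY ⊛ oneMinusXY) ≗₂ onePS
invOneMinusXY-inverse i j = trans (⊛-comm invOneMinusXY oneMinusXY i j) (coefficient i j)
  where
  coefficient : ∀ i j → (oneMinusXY ⊛ invOneMinusXY) i j ≡ onePS i j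
  coefficient zero    zero    = oneMinusXY-⊛-zero invOneMinusXY 0
  coefficient zero    (suc j) = oneMinusXY-⊛-zero invOneMinusXY (suc j)
  coefficient (suc i) zero    = oneMinusXY-⊛-suc-zero invOneMinusXY i
  coefficient (suc i) (suc j) = trans (oneMinusXY-⊛-suc-suc invOneMinusXY i j) (ℤ.+-inverseʳ (invOneMinusXY i j))

substMono-≤ : ∀ p q → p ≤ q → substMono p q ≗₂ ((oneMinusY ^ᴾ p) ⊛ (oneMinusXY ^ᴾ (q ∸ p)))
substMono-≤ p q p≤q = ⊛-congʳ (oneMinusY ^ᴾ p) (begin
  (W ^ᴾ p) ⊛ (V ^ᴾ q)                  ≈⟨ ⊛-congʳ (W ^ᴾ p) (≡⇒≗₂ (cong (V ^ᴾ_) (ℕ.m+[n∸m]≡n p≤q))) ⟨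
  (W ^ᴾ p) ⊛ (V ^ᴾ (p ℕ.+ (q ∸ p)))   ≈⟨ ⊛-congʳ (W ^ᴾ p) (^ᴾ-distribˡ-+-⊛ V p (q ∸ p)) ⟩
  (W ^ᴾ p) ⊛ ((V ^ᴾ p) ⊛ (V ^ᴾ (q ∸ p)))  ≈⟨ ⊛-assoc (W ^ᴾ p) (V ^ᴾ p) (V ^ᴾ (q ∸ p)) ⟨
  ((W ^ᴾ p) ⊛ (V ^ᴾ p)) ⊛ (V ^ᴾ (q ∸ p))  ≈⟨ ⊛-congˡ (V ^ᴾ (q ∸ p)) (^ᴾ-distribʳ-⊛ W V p) ⟨
  ((W ⊛ V) ^ᴾ p) ⊛ (V ^ᴾ (q ∸ p))    ≈⟨ ⊛-congˡ (V ^ᴾ (q ∸ p)) (≗₂-trans (^ᴾ-cong p invOneMinusXY-inverse) (onePS-^ᴾ p)) ⟩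
  onePS ⊛ (V ^ᴾ (q ∸ p))    ≈⟨ ⊛-identityˡ (V ^ᴾ (q ∸ p)) ⟩
  V ^ᴾ (q ∸ p) ∎)
  where
  open SetoidReasoning PS-setoid
  W V : PS
  W = invOneMinusXY
  V = oneMinusXY

i≡0⇒i*j≡0 : ∀ {i} j → i ≡ 0ℤ → i * j ≡ 0ℤ
i≡0⇒i*j≡0 j refl = refl

j≡0⇒i*j≡0 : ∀ i {j} → j ≡ 0ℤ → i * j ≡ 0ℤ
j≡0⇒i*j≡0 i refl = ℤ.*-zeroʳ i

Outside : (xmax ymin ymax i j : ℕ) → Set
Outside xmax ymin ymax i j = xmax < i ⊎ j < ymin ⊎ ymax < j

Supported : PS → (xmax ymin ymax : ℕ) → Set
Supported p xmax ymin ymax = ∀ i j → Outside xmax ymin ymax i j → p i j ≡ 0ℤ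

Supported-≡ : ∀ {p x y z x′ y′ z′} → x ≡ x′ → y ≡ y′ → z ≡ z′ → Supported p x y z → Supported p x′ y′ z′
Supported-≡ refl refl refl supp = supp

<-∸-upper : ∀ {a x y i} → a ≤ x → x ℕ.+ y < i → y < i ∸ a
<-∸-upper {a} {x} {y} {i} a≤x x+y<i =
  ℕ.m+n≤o⇒m≤o∸n (suc y) (ℕ.≤-trans (s≤s (ℕ.≤-trans (ℕ.+-monoʳ-≤ y a≤x) (ℕ.≤-reflexive (ℕ.+-comm y x)))) x+y<i)

<-∸-lower : ∀ {b x y j} → b ≤ j → x ≤ b → j < x ℕ.+ y → j ∸ b < y
<-∸-lower {b} {x} {y} {j} b≤j x≤b j<x+y = ℕ.+-cancelʳ-< b (j ∸ b) y (begin-strict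
  j ∸ b ℕ.+ b ≡⟨ ℕ.m∸n+n≡m b≤j ⟩
  j           <⟨ j<x+y ⟩
  x ℕ.+ y     ≤⟨ ℕ.+-monoˡ-≤ y x≤b ⟩
  b ℕ.+ y     ≡⟨ ℕ.+-comm b y ⟩
  y ℕ.+ b     ∎)
  where open ℕ.≤-Reasoning

⊛-supported : ∀ {p q x₁ l₁ h₁ x₂ l₂ h₂} → Supported p x₁ l₁ h₁ → Supported q x₂ l₂ h₂ →
              Supported (p ⊛ q) (x₁ ℕ.+ x₂) (l₁ ℕ.+ l₂) (h₁ ℕ.+ h₂)
⊛-supported {p} {q} {x₁} {l₁} {h₁} sp sq i j out = sumUpTo-zero i (λ a _ → sumUpTo-zero j (λ b b≤j → term a b b≤j out))
  where
  term : ∀ a b → b ≤ j → Outside _ _ _ i j → p a b * q (i ∸ a) (j ∸ b) ≡ 0ℤ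
  term a b _ (inj₁ x<i) with a ℕ.≤? x₁
  ... | yes a≤x = j≡0⇒i*j≡0 (p a b) (sq _ _ (inj₁ (<-∸-upper a≤x x<i)))
  ... | no  a≰x = i≡0⇒i*j≡0 _ (sp a b (inj₁ (ℕ.≰⇒> a≰x)))
  term a b b≤j (inj₂ (inj₁ j<l)) with l₁ ℕ.≤? b
  ... | yes l≤b = j≡0⇒i*j≡0 (p a b) (sq _ _ (inj₂ (inj₁ (<-∸-lower b≤j l≤b j<l))))
  ... | no  l≰b = i≡0⇒i*j≡0 _ (sp a b (inj₂ (inj₁ (ℕ.≰⇒> l≰b))))
  term a b _ (inj₂ (inj₂ h<j)) with b ℕ.≤? h₁
  ... | yes b≤h = j≡0⇒i*j≡0 (p a b) (sq _ _ (inj₂ (inj₂ (<-∸-upper b≤h h<j))))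
  ... | no  b≰h = i≡0⇒i*j≡0 _ (sp a b (inj₂ (inj₂ (ℕ.≰⇒> b≰h))))

⊛-corner : ∀ {p q x₁ l₁ h₁ x₂ l₂ h₂} → Supported p x₁ l₁ h₁ → Supported q x₂ l₂ h₂ →
           (p ⊛ q) (x₁ ℕ.+ x₂) (l₁ ℕ.+ l₂) ≡ p x₁ l₁ * q x₂ l₂
⊛-corner {p} {q} {x₁} {l₁} {h₁} {x₂} {l₂} sp sq =
  trans (sumUpTo-single (x₁ ℕ.+ x₂) x₁ (ℕ.m≤m+n x₁ x₂) column≡0)
  (trans (sumUpTo-single (l₁ ℕ.+ l₂) l₁ (ℕ.m≤m+n l₁ l₂) entry≡0)
         (cong₂ (λ u v → p x₁ l₁ * q u v) (ℕ.m+n∸m≡n x₁ x₂) (ℕ.m+n∸m≡n l₁ l₂)))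
  where
  column≡0 : ∀ a → a ≤ x₁ ℕ.+ x₂ → a ≢ x₁ →
             sumUpTo (l₁ ℕ.+ l₂) (λ b → p a b * q (x₁ ℕ.+ x₂ ∸ a) (l₁ ℕ.+ l₂ ∸ b)) ≡ 0ℤ
  column≡0 a _ a≢x with a ℕ.≤? x₁
  ... | yes a≤x = sumUpTo-zero (l₁ ℕ.+ l₂) (λ b _ → j≡0⇒i*j≡0 (p a b)
          (sq _ _ (inj₁ (<-∸-upper ℕ.≤-refl (ℕ.+-monoˡ-< x₂ (ℕ.≤∧≢⇒< a≤x a≢x))))))
  ... | no  a≰x = sumUpTo-zero (l₁ ℕ.+ l₂) (λ b _ → i≡0⇒i*j≡0 _ (sp a b (inj₁ (ℕ.≰⇒> a≰x))))
  entry≡0 : ∀ b → b ≤ l₁ ℕ.+ l₂ → b ≢ l₁ → p x₁ b * q (x₁ ℕ.+ x₂ ∸ x₁) (l₁ ℕ.+ l₂ ∸ b) ≡ 0ℤ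
  entry≡0 b b≤ b≢l with l₁ ℕ.≤? b
  ... | yes l≤b = j≡0⇒i*j≡0 (p x₁ b)
          (sq _ _ (inj₂ (inj₁ (<-∸-lower b≤ (ℕ.≤∧≢⇒< l≤b (b≢l ∘ sym)) (ℕ.n<1+n _)))))
  ... | no  l≰b = i≡0⇒i*j≡0 _ (sp x₁ b (inj₂ (inj₁ (ℕ.≰⇒> l≰b))))

∑ : {X : Set} → List X → (X → ℤ) → ℤ
∑ xs f = sumℤ (List.map f xs)

∑-cong : ∀ {X : Set} (xs : List X) {f g : X → ℤ} → (∀ x → f x ≡ g x) → ∑ xs f ≡ ∑ xs g
∑-cong []       f≗g = refl
∑-cong (x ∷ xs) f≗g = cong₂ _+_ (f≗g x) (∑-cong xs f≗g)

∑-++ : ∀ {X : Set} (xs ys : List X) f → ∑ (xs ++ ys) f ≡ ∑ xs f + ∑ ys f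
∑-++ []       ys f = sym (ℤ.+-identityˡ _)
∑-++ (x ∷ xs) ys f rewrite ∑-++ xs ys f = sym (ℤ.+-assoc (f x) _ _)

∑-map : ∀ {X Y : Set} (xs : List X) (g : X → Y) f → ∑ (List.map g xs) f ≡ ∑ xs (f ∘ g)
∑-map []       g f = refl
∑-map (x ∷ xs) g f = cong (λ s → f (g x) + s) (∑-map xs g f)

∑-concatMap : ∀ {X Y : Set} (xs : List X) (g : X → List Y) f → ∑ (concat (List.map g xs)) f ≡ ∑ xs (λ x → ∑ (g x) f)
∑-concatMap []       g f = refl
∑-concatMap (x ∷ xs) g f = trans (∑-++ (g x) _ f) (cong (λ s → ∑ (g x) f + s) (∑-concatMap xs g f))

∑-+ : ∀ {X : Set} (xs : List X) f g → ∑ xs (λ x → f x + g x) ≡ ∑ xs f + ∑ xs g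
∑-+ []       f g = refl
∑-+ (x ∷ xs) f g rewrite ∑-+ xs f g = interchange (f x) (g x) (∑ xs f) (∑ xs g)

∑-*ˡ : ∀ {X : Set} (xs : List X) c f → c * ∑ xs f ≡ ∑ xs (λ x → c * f x)
∑-*ˡ []       c f = ℤ.*-zeroʳ c
∑-*ˡ (x ∷ xs) c f rewrite ℤ.*-distribˡ-+ c (f x) (∑ xs f) | ∑-*ˡ xs c f = refl

∑-*ʳ : ∀ {X : Set} (xs : List X) c f → ∑ xs f * c ≡ ∑ xs (λ x → f x * c)
∑-*ʳ xs c f = trans (ℤ.*-comm _ c) (trans (∑-*ˡ xs c f) (∑-cong xs (λ x → ℤ.*-comm c (f x))))

∑-zero : ∀ {X : Set} (xs : List X) {f : X → ℤ} → (∀ x → f x ≡ 0ℤ) → ∑ xs f ≡ 0ℤ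
∑-zero []       f≡0 = refl
∑-zero (x ∷ xs) f≡0 rewrite f≡0 x | ∑-zero xs f≡0 = refl

∑-sumUpTo : ∀ {X : Set} (xs : List X) n (F : X → ℕ → ℤ) →
            ∑ xs (λ x → sumUpTo n (F x)) ≡ sumUpTo n (λ a → ∑ xs (λ x → F x a))
∑-sumUpTo xs zero    F = refl
∑-sumUpTo xs (suc n) F = trans (∑-+ xs _ _) (cong (_+ ∑ xs (λ x → F x (suc n))) (∑-sumUpTo xs n F))

∑-swap : ∀ {X Y : Set} (xs : List X) (ys : List Y) (F : X → Y → ℤ) →
         ∑ xs (λ x → ∑ ys (F x)) ≡ ∑ ys (λ y → ∑ xs (λ x → F x y))
∑-swap []       ys F = sym (∑-zero ys (λ _ → refl))
∑-swap (x ∷ xs) ys F = trans (cong (λ s → ∑ ys (F x) + s) (∑-swap xs ys F)) (sym (∑-+ ys _ _))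

∑-applyUpTo : ∀ (g : ℕ → ℕ) m (h : ℕ → ℤ) → ∑ (applyUpTo g (suc m)) h ≡ sumUpTo m (h ∘ g)
∑-applyUpTo g zero    h = ℤ.+-identityʳ _
∑-applyUpTo g (suc m) h = trans (cong (λ s → h (g 0) + s) (∑-applyUpTo (g ∘ suc) m h)) (sym (sumUpTo-suc m (h ∘ g)))

[_]·_ : Bool → ℤ → ℤ
[ b ]· v = if b then v else 0ℤ

[]·-T : ∀ {b} v → T b → [ b ]· v ≡ v
[]·-T {true} v _ = refl

[]·-¬T : ∀ {b} v → ¬ T b → [ b ]· v ≡ 0ℤ
[]·-¬T {true}  v ¬b = contradiction _ ¬b
[]·-¬T {false} v _  = refl

[]·-zero : ∀ p → [ p ]· 0ℤ ≡ 0ℤ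
[]·-zero true  = refl
[]·-zero false = refl

[]·-cong : ∀ p {v w} → (T p → v ≡ w) → [ p ]· v ≡ [ p ]· w
[]·-cong true  v≡w = v≡w _
[]·-cong false _   = refl

[]·-∧-* : ∀ p q v w → [ p ∧ q ]· (v * w) ≡ [ p ]· v * [ q ]· w
[]·-∧-* true  true  v w = refl
[]·-∧-* true  false v w = sym (ℤ.*-zeroʳ v)
[]·-∧-* false q     v w = refl

[]·-split : ∀ p q v → (T q → T p) → [ p ]· v ≡ [ p ∧ not q ]· v + [ q ]· v
[]·-split true  true  v _   = sym (ℤ.+-identityˡ v)
[]·-split true  false v _   = sym (ℤ.+-identityʳ v)
[]·-split false true  v q⇒p = contradiction (q⇒p _) (λ ())
[]·-split false false v _   = refl

∑-filterᵇ : ∀ {X : Set} (p : X → Bool) (xs : List X) f → ∑ (filterᵇ p xs) f ≡ ∑ xs (λ x → [ p x ]· f x)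
∑-filterᵇ p []       f = refl
∑-filterᵇ p (x ∷ xs) f with p x
... | true  = cong (λ s → f x + s) (∑-filterᵇ p xs f)
... | false = trans (∑-filterᵇ p xs f) (sym (ℤ.+-identityˡ _))

∑-countᵇ : ∀ {X : Set} (p : X → Bool) xs → ∑ xs (λ x → [ p x ]· 1ℤ) ≡ + countᵇ p xs
∑-countᵇ p []       = refl
∑-countᵇ p (x ∷ xs) with p x
... | true  rewrite ∑-countᵇ p xs = refl
... | false rewrite ∑-countᵇ p xs = refl

∑ᴾ : {X : Set} → List X → (X → PS) → PS
∑ᴾ xs f i j = ∑ xs (λ x → f x i j)

∑ᴾ-⊛ʳ : ∀ {X : Set} (xs : List X) f q → (∑ᴾ xs f ⊛ q) ≗₂ ∑ᴾ xs (λ x → f x ⊛ q)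
∑ᴾ-⊛ʳ xs f q i j = sym (trans (∑-sumUpTo xs i _)
  (sumUpTo-cong i (λ a _ → trans (∑-sumUpTo xs j _) (sumUpTo-cong j (λ b _ → sym (∑-*ʳ xs _ _))))))

∑ᴾ-⊛ˡ : ∀ {X : Set} (xs : List X) f q → (q ⊛ ∑ᴾ xs f) ≗₂ ∑ᴾ xs (λ x → q ⊛ f x)
∑ᴾ-⊛ˡ xs f q i j =
  trans (⊛-comm q (∑ᴾ xs f) i j) (trans (∑ᴾ-⊛ʳ xs f q i j) (∑-cong xs (λ x → ⊛-comm (f x) q i j)))

T-∧⁻ : ∀ {x y} → T (x ∧ y) → T x × T y
T-∧⁻ = Equivalence.to T-∧

T-∧⁺ : ∀ {x y} → T x → T y → T (x ∧ y)
T-∧⁺ tx ty = Equivalence.from T-∧ (tx , ty)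

T-not⇒¬T : ∀ {x} → T (not x) → ¬ T x
T-not⇒¬T {true} () _

≤ⱽ-refl : ∀ {n} (a : Vec ℕ n) → T (a ≤ⱽ a)
≤ⱽ-refl []      = _
≤ⱽ-refl (x ∷ a) = T-∧⁺ (ℕ.≤⇒≤ᵇ (ℕ.≤-refl {x})) (≤ⱽ-refl a)

==ⱽ⇒≡ : ∀ {n} (a b : Vec ℕ n) → T (a ==ⱽ b) → a ≡ b
==ⱽ⇒≡ []      []      _   = refl
==ⱽ⇒≡ (x ∷ a) (y ∷ b) a=b with T-∧⁻ {x ℕ.≡ᵇ y} a=b
... | x=y , a=b′ = cong₂ _∷_ (ℕ.≡ᵇ⇒≡ x y x=y) (==ⱽ⇒≡ a b a=b′)

≡⇒==ⱽ : ∀ {n} (a b : Vec ℕ n) → a ≡ b → T (a ==ⱽ b)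
≡⇒==ⱽ []      []        _    = _
≡⇒==ⱽ (x ∷ a) (.x ∷ .a) refl = T-∧⁺ (ℕ.≡⇒≡ᵇ x x refl) (≡⇒==ⱽ a a refl)

==ⱽ⇒≤ⱽ : ∀ {n} (a b : Vec ℕ n) → T (a ==ⱽ b) → T (a ≤ⱽ b)
==ⱽ⇒≤ⱽ a b a=b rewrite ==ⱽ⇒≡ a b a=b = ≤ⱽ-refl b

≤ⱽ⇒lookup≤ : ∀ {n} (a b : Vec ℕ n) → T (a ≤ⱽ b) → ∀ k → lookup a k ≤ lookup b k
≤ⱽ⇒lookup≤ (x ∷ a) (y ∷ b) a≤b k with T-∧⁻ {x ℕ.≤ᵇ y} a≤b
≤ⱽ⇒lookup≤ (x ∷ a) (y ∷ b) a≤b Fin.zero    | x≤y , _    = ℕ.≤ᵇ⇒≤ x y x≤y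
≤ⱽ⇒lookup≤ (x ∷ a) (y ∷ b) a≤b (Fin.suc k) | _   , a≤b′ = ≤ⱽ⇒lookup≤ a b a≤b′ k

≤ⱽ⇒ht≤ : ∀ {n} (a b : Vec ℕ n) → T (a ≤ⱽ b) → ht a ≤ ht b
≤ⱽ⇒ht≤ []      []      _   = z≤n
≤ⱽ⇒ht≤ (x ∷ a) (y ∷ b) a≤b with T-∧⁻ {x ℕ.≤ᵇ y} a≤b
... | x≤y , a≤b′ = ℕ.+-mono-≤ (ℕ.≤ᵇ⇒≤ x y x≤y) (≤ⱽ⇒ht≤ a b a≤b′)

≤ⱽ∧≢⇒ht< : ∀ {n} (a b : Vec ℕ n) → T (a ≤ⱽ b) → ¬ T (a ==ⱽ b) → ht a < ht b
≤ⱽ∧≢⇒ht< []      []      _   a≠b = contradiction _ a≠b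
≤ⱽ∧≢⇒ht< (x ∷ a) (y ∷ b) a≤b a≠b with T-∧⁻ {x ℕ.≤ᵇ y} a≤b | x ℕ.≟ y
... | _ , a≤b′ | yes refl =
  ℕ.+-monoʳ-< x (≤ⱽ∧≢⇒ht< a b a≤b′ (a≠b ∘ T-∧⁺ (ℕ.≡⇒≡ᵇ x x refl)))
... | x≤y , a≤b′ | no x≢y =
  ℕ.+-mono-<-≤ (ℕ.≤∧≢⇒< (ℕ.≤ᵇ⇒≤ x y x≤y) x≢y) (≤ⱽ⇒ht≤ a b a≤b′)

∑-box-suc : ∀ m n (H : Vec ℕ (suc n) → ℤ) → ∑ (box m (suc n)) H ≡ sumUpTo m (λ x → ∑ (box m n) (H ∘ (x ∷_)))
∑-box-suc m n H = begin
  ∑ (concat (List.map (λ x → List.map (x ∷_) (box m n)) (List.upTo (suc m)))) H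
    ≡⟨ ∑-concatMap (List.upTo (suc m)) (λ x → List.map (x ∷_) (box m n)) H ⟩
  ∑ (List.upTo (suc m)) (λ x → ∑ (List.map (x ∷_) (box m n)) H)
    ≡⟨ ∑-cong (List.upTo (suc m)) (λ x → ∑-map (box m n) (x ∷_) H) ⟩
  ∑ (List.upTo (suc m)) (λ x → ∑ (box m n) (H ∘ (x ∷_)))
    ≡⟨ ∑-applyUpTo (λ x → x) m _ ⟩
  sumUpTo m (λ x → ∑ (box m n) (H ∘ (x ∷_))) ∎
  where open ≡-Reasoning

∑-box-cong : ∀ m n {F G : Vec ℕ n → ℤ} → (∀ c → All (_≤ m) c → F c ≡ G c) → ∑ (box m n) F ≡ ∑ (box m n) G
∑-box-cong m zero    F≗G = cong (_+ 0ℤ) (F≗G [] [])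
∑-box-cong m (suc n) {F} {G} F≗G = begin
  ∑ (box m (suc n)) F                             ≡⟨ ∑-box-suc m n F ⟩
  sumUpTo m (λ x → ∑ (box m n) (F ∘ (x ∷_)))
    ≡⟨ sumUpTo-cong m (λ x x≤m → ∑-box-cong m n (λ c c≤m → F≗G (x ∷ c) (x≤m ∷ c≤m))) ⟩
  sumUpTo m (λ x → ∑ (box m n) (G ∘ (x ∷_)))      ≡⟨ ∑-box-suc m n G ⟨
  ∑ (box m (suc n)) G                             ∎
  where open ≡-Reasoning

∑-box-product : ∀ m n (g : ℕ → ℤ) (h : Vec ℕ n → ℤ) (H : Vec ℕ (suc n) → ℤ) →
                (∀ x c → H (x ∷ c) ≡ g x * h c) → ∑ (box m (suc n)) H ≡ sumUpTo m g * ∑ (box m n) h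
∑-box-product m n g h H H≡g*h = begin
  ∑ (box m (suc n)) H                             ≡⟨ ∑-box-suc m n H ⟩
  sumUpTo m (λ x → ∑ (box m n) (H ∘ (x ∷_)))
    ≡⟨ sumUpTo-cong m (λ x _ → trans (∑-cong (box m n) (H≡g*h x)) (sym (∑-*ˡ (box m n) (g x) h))) ⟩
  sumUpTo m (λ x → g x * ∑ (box m n) h)           ≡⟨ sumUpTo-*ʳ m (∑ (box m n) h) g ⟨
  sumUpTo m g * ∑ (box m n) h                     ∎
  where open ≡-Reasoning

sumUpTo-restrict : ∀ m y (f : ℕ → ℤ) → y ≤ m → sumUpTo m (λ x → [ x ℕ.≤ᵇ y ]· f x) ≡ sumUpTo y f
sumUpTo-restrict m y f y≤m = sumUpTo-truncate m y y≤m (λ x x≤y → []·-T (f x) (ℕ.≤⇒≤ᵇ x≤y))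
  (λ x y<x → []·-¬T (f x) (ℕ.<⇒≱ y<x ∘ ℕ.≤ᵇ⇒≤ x y))

∑-box-δ : ∀ m n (b : Vec ℕ n) (g : Vec ℕ n → ℤ) → All (_≤ m) b → ∑ (box m n) (λ c → [ c ==ⱽ b ]· g c) ≡ g b
∑-box-δ m n b g b≤m = begin
  ∑ (box m n) (λ c → [ c ==ⱽ b ]· g c)        ≡⟨ ∑-cong (box m n) pull ⟩
  ∑ (box m n) (λ c → g b * [ c ==ⱽ b ]· 1ℤ)   ≡⟨ ∑-*ˡ (box m n) (g b) _ ⟨
  g b * ∑ (box m n) (λ c → [ c ==ⱽ b ]· 1ℤ)   ≡⟨ cong (g b *_) (count n b b≤m) ⟩
  g b * 1ℤ                                    ≡⟨ ℤ.*-identityʳ (g b) ⟩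
  g b                                         ∎
  where
  open ≡-Reasoning
  pull : ∀ c → [ c ==ⱽ b ]· g c ≡ g b * [ c ==ⱽ b ]· 1ℤ
  pull c with T? (c ==ⱽ b)
  ... | yes c=b = begin
    [ c ==ⱽ b ]· g c          ≡⟨ []·-T (g c) c=b ⟩
    g c                       ≡⟨ cong g (==ⱽ⇒≡ c b c=b) ⟩
    g b                       ≡⟨ ℤ.*-identityʳ (g b) ⟨
    g b * 1ℤ                  ≡⟨ cong (g b *_) ([]·-T 1ℤ c=b) ⟨
    g b * [ c ==ⱽ b ]· 1ℤ     ∎
  ... | no  c≠b = begin
    [ c ==ⱽ b ]· g c          ≡⟨ []·-¬T (g c) c≠b ⟩
    0ℤ                        ≡⟨ ℤ.*-zeroʳ (g b) ⟨
    g b * 0ℤ                  ≡⟨ cong (g b *_) ([]·-¬T 1ℤ c≠b) ⟨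
    g b * [ c ==ⱽ b ]· 1ℤ     ∎
  count : ∀ n (b : Vec ℕ n) → All (_≤ m) b → ∑ (box m n) (λ c → [ c ==ⱽ b ]· 1ℤ) ≡ 1ℤ
  count zero    []      []          = refl
  count (suc n) (y ∷ b) (y≤m ∷ b≤m) =
    trans (∑-box-product m n _ _ _ (λ x c → []·-∧-* (x ℕ.≡ᵇ y) (c ==ⱽ b) 1ℤ 1ℤ))
          (cong₂ _*_ (trans (sumUpTo-single m y y≤m (λ x _ x≢y → []·-¬T 1ℤ (x≢y ∘ ℕ.≡ᵇ⇒≡ x y)))
                            ([]·-T 1ℤ (ℕ.≡⇒≡ᵇ y y refl)))
                     (count n b b≤m))

boxVolume : ∀ {n} → Vec ℕ n → ℕ
boxVolume []      = 1
boxVolume (y ∷ b) = suc y ℕ.* boxVolume b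

∑-box-≤ⱽ : ∀ m n (b : Vec ℕ n) → All (_≤ m) b → ∑ (box m n) (λ c → [ c ≤ⱽ b ]· 1ℤ) ≡ + boxVolume b
∑-box-≤ⱽ m zero    []      []          = refl
∑-box-≤ⱽ m (suc n) (y ∷ b) (y≤m ∷ b≤m) = begin
  ∑ (box m (suc n)) (λ c → [ c ≤ⱽ (y ∷ b) ]· 1ℤ)
    ≡⟨ ∑-box-product m n _ _ _ (λ x c → []·-∧-* (x ℕ.≤ᵇ y) (c ≤ⱽ b) 1ℤ 1ℤ) ⟩
  sumUpTo m (λ x → [ x ℕ.≤ᵇ y ]· 1ℤ) * ∑ (box m n) (λ c → [ c ≤ⱽ b ]· 1ℤ)
    ≡⟨ cong₂ _*_ (trans (sumUpTo-restrict m y (λ _ → 1ℤ) y≤m) (sumUpTo-ones y)) (∑-box-≤ⱽ m n b b≤m) ⟩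
  + suc y * + boxVolume b
    ≡⟨ ℤ.pos-* (suc y) (boxVolume b) ⟨
  + boxVolume (y ∷ b) ∎
  where
  open ≡-Reasoning
  sumUpTo-ones : ∀ y → sumUpTo y (λ _ → 1ℤ) ≡ + suc y
  sumUpTo-ones zero    = refl
  sumUpTo-ones (suc y) rewrite sumUpTo-ones y = cong (λ k → + suc k) (ℕ.+-comm y 1)

ht<boxVolume : ∀ {n} (b : Vec ℕ n) → ht b < boxVolume b
ht<boxVolume []      = s≤s z≤n
ht<boxVolume (y ∷ b) = begin-strict
  y ℕ.+ ht b                 <⟨ ℕ.+-monoʳ-< y (ht<boxVolume b) ⟩
  y ℕ.+ V                    ≤⟨ ℕ.+-monoˡ-≤ V (ℕ.m≤m*n y V) ⟩
  y ℕ.* V ℕ.+ V              ≡⟨ ℕ.+-comm (y ℕ.* V) V ⟩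
  boxVolume (y ∷ b)          ∎
  where
  open ℕ.≤-Reasoning
  V : ℕ
  V = boxVolume b
  instance _ = ℕ.>-nonZero (ℕ.≤-<-trans z≤n (ht<boxVolume b))

-- Möbius functions of the chain ℕ and of the product order on ℕⁿ

μℕ : ℕ → ℕ → ℤ
μℕ zero    zero          = 1ℤ
μℕ zero    (suc zero)    = - 1ℤ
μℕ zero    (suc (suc _)) = 0ℤ
μℕ (suc _) zero          = 0ℤ
μℕ (suc x) (suc y)       = μℕ x y

μⱽ : ∀ {n} → Vec ℕ n → Vec ℕ n → ℤ
μⱽ []      []      = 1ℤ
μⱽ (x ∷ a) (y ∷ b) = μℕ x y * μⱽ a b

μℕ-refl : ∀ x → μℕ x x ≡ 1ℤ
μℕ-refl zero    = refl
μℕ-refl (suc x) = μℕ-refl x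

μℕ-suc : ∀ x → μℕ x (suc x) ≡ - 1ℤ
μℕ-suc zero    = refl
μℕ-suc (suc x) = μℕ-suc x

μℕ-other : ∀ x y → x ≢ y → suc x ≢ y → μℕ x y ≡ 0ℤ
μℕ-other zero    zero          x≢y _    = contradiction refl x≢y
μℕ-other zero    (suc zero)    _   1≢y  = contradiction refl 1≢y
μℕ-other zero    (suc (suc _)) _   _    = refl
μℕ-other (suc x) zero          _   _    = refl
μℕ-other (suc x) (suc y)       x≢y x+1≢y = μℕ-other x y (x≢y ∘ cong suc) (x+1≢y ∘ cong suc)

μℕ≢0⇒≤ : ∀ x y → μℕ x y ≢ 0ℤ → x ≤ y
μℕ≢0⇒≤ zero    y       _   = z≤n
μℕ≢0⇒≤ (suc x) zero    μ≢0 = contradiction refl μ≢0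
μℕ≢0⇒≤ (suc x) (suc y) μ≢0 = s≤s (μℕ≢0⇒≤ x y μ≢0)

sumUpTo-μℕ : ∀ u y → sumUpTo y (μℕ u) ≡ [ u ℕ.≡ᵇ y ]· 1ℤ
sumUpTo-μℕ zero    zero    = refl
sumUpTo-μℕ (suc u) zero    = refl
sumUpTo-μℕ u       (suc y) = trans (cong (_+ μℕ u (suc y)) (sumUpTo-μℕ u y)) (step u y)
  where
  step : ∀ u y → [ u ℕ.≡ᵇ y ]· 1ℤ + μℕ u (suc y) ≡ [ u ℕ.≡ᵇ suc y ]· 1ℤ
  step zero          zero    = refl
  step zero          (suc y) = refl
  step (suc zero)    zero    = refl
  step (suc (suc u)) zero    = refl
  step (suc u)       (suc y) = step u y

μⱽ≢0⇒≤ⱽ : ∀ {n} (a b : Vec ℕ n) → μⱽ a b ≢ 0ℤ → T (a ≤ⱽ b)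
μⱽ≢0⇒≤ⱽ []      []      _   = _
μⱽ≢0⇒≤ⱽ (x ∷ a) (y ∷ b) μ≢0 =
  T-∧⁺ (ℕ.≤⇒≤ᵇ (μℕ≢0⇒≤ x y (μ≢0 ∘ i≡0⇒i*j≡0 (μⱽ a b)))) (μⱽ≢0⇒≤ⱽ a b (μ≢0 ∘ j≡0⇒i*j≡0 (μℕ x y)))

μⱽ-≰ : ∀ {n} (a b : Vec ℕ n) → ¬ T (a ≤ⱽ b) → μⱽ a b ≡ 0ℤ
μⱽ-≰ a b a≰b = decidable-stable (μⱽ a b ℤ.≟ 0ℤ) (a≰b ∘ μⱽ≢0⇒≤ⱽ a b)

μⱽ-refl : ∀ {n} (a : Vec ℕ n) → μⱽ a a ≡ 1ℤ
μⱽ-refl []      = refl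
μⱽ-refl (x ∷ a) rewrite μℕ-refl x | μⱽ-refl a = refl

∑-box-μⱽ : ∀ m n (a b : Vec ℕ n) → All (_≤ m) b → ∑ (box m n) (λ c → [ c ≤ⱽ b ]· μⱽ a c) ≡ [ a ==ⱽ b ]· 1ℤ
∑-box-μⱽ m zero    []      []      []          = refl
∑-box-μⱽ m (suc n) (u ∷ a) (y ∷ b) (y≤m ∷ b≤m) = begin
  ∑ (box m (suc n)) (λ c → [ c ≤ⱽ (y ∷ b) ]· μⱽ (u ∷ a) c)
    ≡⟨ ∑-box-product m n _ _ _ (λ x c → []·-∧-* (x ℕ.≤ᵇ y) (c ≤ⱽ b) (μℕ u x) (μⱽ a c)) ⟩
  sumUpTo m (λ x → [ x ℕ.≤ᵇ y ]· μℕ u x) * ∑ (box m n) (λ c → [ c ≤ⱽ b ]· μⱽ a c)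
    ≡⟨ cong₂ _*_ (trans (sumUpTo-restrict m y (μℕ u) y≤m) (sumUpTo-μℕ u y)) (∑-box-μⱽ m n a b b≤m) ⟩
  [ u ℕ.≡ᵇ y ]· 1ℤ * [ a ==ⱽ b ]· 1ℤ
    ≡⟨ []·-∧-* (u ℕ.≡ᵇ y) (a ==ⱽ b) 1ℤ 1ℤ ⟨
  [ (u ∷ a) ==ⱽ (y ∷ b) ]· 1ℤ ∎
  where open ≡-Reasoning

∑-box-μⱽ-strict : ∀ m n (a b : Vec ℕ n) → All (_≤ m) b → ¬ T (a ==ⱽ b) →
                  ∑ (box m n) (λ c → [ c ≤ⱽ b ∧ not (c ==ⱽ b) ]· μⱽ a c) ≡ - μⱽ a b
∑-box-μⱽ-strict m n a b b≤m a≠b = inverseʳ-unique (μⱽ a b) _ (begin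
  μⱽ a b + ∑ (box m n) (λ c → [ c ≤ⱽ b ∧ not (c ==ⱽ b) ]· μⱽ a c)
    ≡⟨ ℤ.+-comm (μⱽ a b) _ ⟩
  ∑ (box m n) (λ c → [ c ≤ⱽ b ∧ not (c ==ⱽ b) ]· μⱽ a c) + μⱽ a b
    ≡⟨ cong₂ _+_ (refl {x = ∑ (box m n) _}) (∑-box-δ m n b (μⱽ a) b≤m) ⟨
  ∑ (box m n) (λ c → [ c ≤ⱽ b ∧ not (c ==ⱽ b) ]· μⱽ a c) + ∑ (box m n) (λ c → [ c ==ⱽ b ]· μⱽ a c)
    ≡⟨ ∑-+ (box m n) _ _ ⟨
  ∑ (box m n) (λ c → [ c ≤ⱽ b ∧ not (c ==ⱽ b) ]· μⱽ a c + [ c ==ⱽ b ]· μⱽ a c)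
    ≡⟨ ∑-cong (box m n) (λ c → sym ([]·-split (c ≤ⱽ b) (c ==ⱽ b) (μⱽ a c) (==ⱽ⇒≤ⱽ c b))) ⟩
  ∑ (box m n) (λ c → [ c ≤ⱽ b ]· μⱽ a c)
    ≡⟨ ∑-box-μⱽ m n a b b≤m ⟩
  [ a ==ⱽ b ]· 1ℤ
    ≡⟨ []·-¬T 1ℤ a≠b ⟩
  0ℤ ∎)
  where open ≡-Reasoning

-- The Möbius function of a lower set of a box

∸-pred : ∀ {a b c f} → c < b → b ∸ a ≤ suc f → c ∸ a ≤ f
∸-pred {a} {b} {c} {f} c<b b∸a≤1+f with a ℕ.≤? c
... | yes a≤c = ℕ.≤-pred (ℕ.<-≤-trans (ℕ.∸-monoˡ-< c<b a≤c) b∸a≤1+f)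
... | no  a≰c = ℕ.≤-trans (ℕ.≤-reflexive (ℕ.m≤n⇒m∸n≡0 (ℕ.<⇒≤ (ℕ.≰⇒> a≰c)))) z≤n

module LowerSet (m n : ℕ) (P : Vec ℕ n → Bool) (P-down : ∀ c b → T (c ≤ⱽ b) → T (P b) → T (P c)) where

  L : List (Vec ℕ n)
  L = filterᵇ P (box m n)

  mobiusF-≰ : ∀ f a b → ¬ T (a ≤ⱽ b) → mobiusF L f a b ≡ 0ℤ
  mobiusF-≰ f a b a≰b with a ≤ⱽ b
  ... | true  = contradiction _ a≰b
  ... | false = refl

  mobiusF-≡ : ∀ f a → mobiusF L f a a ≡ 1ℤ
  mobiusF-≡ f a with a ≤ⱽ a | ≤ⱽ-refl a | a ==ⱽ a | ≡⇒==ⱽ a a refl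
  ... | true | _ | true | _ = refl

  mobiusF-suc : ∀ f a b → T (a ≤ⱽ b) → ¬ T (a ==ⱽ b) →
    mobiusF L (suc f) a b ≡ - ∑ (filterᵇ (λ c → (a ≤ⱽ c) ∧ (c ≤ⱽ b) ∧ not (c ==ⱽ b)) L) (mobiusF L f a)
  mobiusF-suc f a b a≤b a≠b with a ≤ⱽ b | a ==ⱽ b
  ... | true | true  = contradiction _ a≠b
  ... | true | false = refl

  -- Below an element of L the lower set looks like ℕⁿ, so the Möbius recursion on L is that of μⱽ;
  -- each recursive call lowers ht b, so fuel ht b ∸ ht a suffices.
  mobiusF-lowerSet : ∀ f a b → T (P b) → All (_≤ m) b → ht b ∸ ht a ≤ f → mobiusF L f a b ≡ μⱽ a b
  mobiusF-lowerSet f a b Pb b≤m fuel with T? (a ≤ⱽ b) | T? (a ==ⱽ b)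
  ... | no a≰b | _ = trans (mobiusF-≰ f a b a≰b) (sym (μⱽ-≰ a b a≰b))
  ... | yes _  | yes a=b rewrite ==ⱽ⇒≡ a b a=b = trans (mobiusF-≡ f b) (sym (μⱽ-refl b))
  mobiusF-lowerSet zero a b Pb b≤m fuel | yes a≤b | no a≠b =
    contradiction (ℕ.m∸n≡0⇒m≤n (ℕ.n≤0⇒n≡0 fuel)) (ℕ.<⇒≱ (≤ⱽ∧≢⇒ht< a b a≤b a≠b))
  mobiusF-lowerSet (suc f) a b Pb b≤m fuel | yes a≤b | no a≠b = begin
    mobiusF L (suc f) a b
      ≡⟨ mobiusF-suc f a b a≤b a≠b ⟩
    - ∑ (filterᵇ q L) (mobiusF L f a)
      ≡⟨ cong -_ (trans (∑-filterᵇ q L _) (∑-filterᵇ P (box m n) _)) ⟩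
    - ∑ (box m n) (λ c → [ P c ]· [ q c ]· mobiusF L f a c)
      ≡⟨ cong -_ (∑-box-cong m n strictlyBelow) ⟩
    - ∑ (box m n) (λ c → [ c ≤ⱽ b ∧ not (c ==ⱽ b) ]· μⱽ a c)
      ≡⟨ cong -_ (∑-box-μⱽ-strict m n a b b≤m a≠b) ⟩
    - - μⱽ a b
      ≡⟨ ℤ.neg-involutive (μⱽ a b) ⟩
    μⱽ a b ∎
    where
    open ≡-Reasoning
    q : Vec ℕ n → Bool
    q c = (a ≤ⱽ c) ∧ (c ≤ⱽ b) ∧ not (c ==ⱽ b)
    strictlyBelow : ∀ c → All (_≤ m) c →
                    [ P c ]· [ q c ]· mobiusF L f a c ≡ [ c ≤ⱽ b ∧ not (c ==ⱽ b) ]· μⱽ a c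
    strictlyBelow c c≤m with T? (c ≤ⱽ b ∧ not (c ==ⱽ b))
    ... | no c≮b = begin
      [ P c ]· [ q c ]· mobiusF L f a c   ≡⟨ cong [ P c ]·_ ([]·-¬T {q c} _ (c≮b ∘ proj₂ ∘ T-∧⁻ {a ≤ⱽ c})) ⟩
      [ P c ]· 0ℤ                         ≡⟨ []·-zero (P c) ⟩
      0ℤ                                  ≡⟨ []·-¬T _ c≮b ⟨
      [ c ≤ⱽ b ∧ not (c ==ⱽ b) ]· μⱽ a c  ∎
    ... | yes c<b with T-∧⁻ {c ≤ⱽ b} c<b
    ... | c≤b , c≠b = begin
      [ P c ]· [ q c ]· mobiusF L f a c   ≡⟨ []·-T _ (P-down c b c≤b Pb) ⟩
      [ q c ]· mobiusF L f a c            ≡⟨ below ⟩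
      μⱽ a c                              ≡⟨ []·-T _ c<b ⟨
      [ c ≤ⱽ b ∧ not (c ==ⱽ b) ]· μⱽ a c  ∎
      where
      below : [ q c ]· mobiusF L f a c ≡ μⱽ a c
      below with T? (a ≤ⱽ c)
      ... | no  a≰c = trans ([]·-¬T {q c} _ (a≰c ∘ proj₁ ∘ T-∧⁻ {a ≤ⱽ c})) (sym (μⱽ-≰ a c a≰c))
      ... | yes a≤c = trans ([]·-T {q c} _ (T-∧⁺ a≤c c<b))
        (mobiusF-lowerSet f a c (P-down c b c≤b Pb) c≤m (∸-pred {ht a} (≤ⱽ∧≢⇒ht< c b c≤b (T-not⇒¬T c≠b)) fuel))

-- The contribution of a single b to the transmuted M-triangle

xyMinusY : PS
xyMinusY = oneMinusY ⊕ ((- 1ℤ) · oneMinusXY)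

chainTerm : ℕ → ℕ → PS
chainTerm x y = μℕ x y · ((oneMinusY ^ᴾ x) ⊛ (oneMinusXY ^ᴾ (y ∸ x)))

transmutedTerm : ∀ {n} → Vec ℕ n → Vec ℕ n → PS
transmutedTerm a b = μⱽ a b · ((oneMinusY ^ᴾ ht a) ⊛ (oneMinusXY ^ᴾ (ht b ∸ ht a)))

chainFactor : ℕ → PS
chainFactor zero    = onePS
chainFactor (suc y) = (oneMinusY ^ᴾ y) ⊛ xyMinusY

productFactor : ∀ {n} → Vec ℕ n → PS
productFactor []      = onePS
productFactor (y ∷ b) = chainFactor y ⊛ productFactor b

·-cong-≢0 : ∀ c {p q} → (c ≢ 0ℤ → p ≗₂ q) → (c · p) ≗₂ (c · q)
·-cong-≢0 c p≗q i j with c ℤ.≟ 0ℤ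
... | yes refl = refl
... | no  c≢0  = cong (c *_) (p≗q c≢0 i j)

·-⊛-· : ∀ c d p q → ((c · p) ⊛ (d · q)) ≗₂ ((c * d) · (p ⊛ q))
·-⊛-· c d p q i j =
  trans (⊛-scaleˡ c p (d · q) i j) (trans (cong (c *_) (⊛-scaleʳ d p q i j)) (sym (ℤ.*-assoc c d _)))

[m+n]∸[o+p]≡[m∸o]+[n∸p] : ∀ {m n o p} → o ≤ m → p ≤ n → (m ℕ.+ n) ∸ (o ℕ.+ p) ≡ (m ∸ o) ℕ.+ (n ∸ p)
[m+n]∸[o+p]≡[m∸o]+[n∸p] {m} {n} {o} {p} o≤m p≤n = begin
  (m ℕ.+ n) ∸ (o ℕ.+ p)   ≡⟨ ℕ.∸-+-assoc (m ℕ.+ n) o p ⟨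
  (m ℕ.+ n) ∸ o ∸ p       ≡⟨ cong (_∸ p) (ℕ.+-∸-comm n o≤m) ⟩
  ((m ∸ o) ℕ.+ n) ∸ p     ≡⟨ ℕ.+-∸-assoc (m ∸ o) p≤n ⟩
  (m ∸ o) ℕ.+ (n ∸ p)     ∎
  where open ≡-Reasoning

transmutedTerm-∷ : ∀ {n} x y (a b : Vec ℕ n) → transmutedTerm (x ∷ a) (y ∷ b) ≗₂ (chainTerm x y ⊛ transmutedTerm a b)
transmutedTerm-∷ x y a b = ≗₂-trans (·-cong-≢0 (μℕ x y * μⱽ a b) split)
  (≗₂-sym (·-⊛-· (μℕ x y) (μⱽ a b) ((A ^ᴾ x) ⊛ (V ^ᴾ (y ∸ x))) ((A ^ᴾ ht a) ⊛ (V ^ᴾ (ht b ∸ ht a)))))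
  where
  open SetoidReasoning PS-setoid
  A V : PS
  A = oneMinusY
  V = oneMinusXY
  split : μℕ x y * μⱽ a b ≢ 0ℤ →
          ((A ^ᴾ (x ℕ.+ ht a)) ⊛ (V ^ᴾ ((y ℕ.+ ht b) ∸ (x ℕ.+ ht a))))
            ≗₂ (((A ^ᴾ x) ⊛ (V ^ᴾ (y ∸ x))) ⊛ ((A ^ᴾ ht a) ⊛ (V ^ᴾ (ht b ∸ ht a))))
  split μ≢0 = begin
    (A ^ᴾ (x ℕ.+ ht a)) ⊛ (V ^ᴾ ((y ℕ.+ ht b) ∸ (x ℕ.+ ht a)))
      ≈⟨ ⊛-congʳ (A ^ᴾ (x ℕ.+ ht a)) (≡⇒≗₂ (cong (V ^ᴾ_) ([m+n]∸[o+p]≡[m∸o]+[n∸p] x≤y a≤b))) ⟩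
    (A ^ᴾ (x ℕ.+ ht a)) ⊛ (V ^ᴾ ((y ∸ x) ℕ.+ (ht b ∸ ht a)))
      ≈⟨ ⊛-cong (^ᴾ-distribˡ-+-⊛ A x (ht a)) (^ᴾ-distribˡ-+-⊛ V (y ∸ x) (ht b ∸ ht a)) ⟩
    ((A ^ᴾ x) ⊛ (A ^ᴾ ht a)) ⊛ ((V ^ᴾ (y ∸ x)) ⊛ (V ^ᴾ (ht b ∸ ht a)))
      ≈⟨ ⊛-interchange (A ^ᴾ x) (A ^ᴾ ht a) (V ^ᴾ (y ∸ x)) (V ^ᴾ (ht b ∸ ht a)) ⟩
    ((A ^ᴾ x) ⊛ (V ^ᴾ (y ∸ x))) ⊛ ((A ^ᴾ ht a) ⊛ (V ^ᴾ (ht b ∸ ht a))) ∎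
    where
    x≤y : x ≤ y
    x≤y = μℕ≢0⇒≤ x y (μ≢0 ∘ i≡0⇒i*j≡0 (μⱽ a b))
    a≤b : ht a ≤ ht b
    a≤b = ≤ⱽ⇒ht≤ a b (μⱽ≢0⇒≤ⱽ a b (μ≢0 ∘ j≡0⇒i*j≡0 (μℕ x y)))

∑-chainTerm : ∀ m y → y ≤ m → ∑ᴾ (List.upTo (suc m)) (λ x → chainTerm x y) ≗₂ chainFactor y
∑-chainTerm m zero _ i j = begin
  ∑ (List.upTo (suc m)) (λ x → chainTerm x 0 i j)   ≡⟨ ∑-applyUpTo (λ x → x) m _ ⟩
  sumUpTo m (λ x → chainTerm x 0 i j)               ≡⟨ sumUpTo-single m 0 z≤n (λ { zero _ x≢0 → contradiction refl x≢0
                                                                               ; (suc x) _ _ → refl }) ⟩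
  1ℤ * (onePS ⊛ onePS) i j                          ≡⟨ ℤ.*-identityˡ _ ⟩
  (onePS ⊛ onePS) i j                               ≡⟨ ⊛-identityˡ onePS i j ⟩
  onePS i j                                         ∎
  where open ≡-Reasoning
∑-chainTerm m (suc y) y<m i j = begin
  ∑ (List.upTo (suc m)) (λ x → chainTerm x (suc y) i j)
    ≡⟨ ∑-applyUpTo (λ x → x) m _ ⟩
  sumUpTo m (λ x → chainTerm x (suc y) i j)
    ≡⟨ sumUpTo-pair m y y<m (λ x _ x≢y x≢y+1 → i≡0⇒i*j≡0 _ (μℕ-other x (suc y) x≢y+1 (x≢y ∘ ℕ.suc-injective))) ⟩
  chainTerm y (suc y) i j + chainTerm (suc y) (suc y) i j
    ≡⟨ cong₂ _+_ (cong₂ _*_ (μℕ-suc y) (lower i j)) (trans (cong₂ _*_ (μℕ-refl (suc y)) (upper i j)) (ℤ.*-identityˡ _)) ⟩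
  (- 1ℤ) * ((A ^ᴾ y) ⊛ V) i j + ((A ^ᴾ y) ⊛ A) i j
    ≡⟨ ℤ.+-comm ((- 1ℤ) * ((A ^ᴾ y) ⊛ V) i j) (((A ^ᴾ y) ⊛ A) i j) ⟩
  ((A ^ᴾ y) ⊛ A) i j + (- 1ℤ) * ((A ^ᴾ y) ⊛ V) i j
    ≡⟨ cong₂ _+_ (refl {x = ((A ^ᴾ y) ⊛ A) i j}) (⊛-scaleʳ (- 1ℤ) (A ^ᴾ y) V i j) ⟨
  (((A ^ᴾ y) ⊛ A) ⊕ ((A ^ᴾ y) ⊛ ((- 1ℤ) · V))) i j
    ≡⟨ ⊛-distribˡ-⊕ (A ^ᴾ y) A ((- 1ℤ) · V) i j ⟨
  ((A ^ᴾ y) ⊛ xyMinusY) i j ∎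
  where
  open ≡-Reasoning
  A V : PS
  A = oneMinusY
  V = oneMinusXY
  lower : ((A ^ᴾ y) ⊛ (V ^ᴾ (suc y ∸ y))) ≗₂ ((A ^ᴾ y) ⊛ V)
  lower = ⊛-congʳ (A ^ᴾ y) (≗₂-trans (≡⇒≗₂ (cong (V ^ᴾ_) (trans (ℕ.+-∸-assoc 1 (ℕ.≤-refl {y})) (cong suc (ℕ.n∸n≡0 y)))))
                                     (⊛-identityʳ V))
  upper : ((A ^ᴾ suc y) ⊛ (V ^ᴾ (y ∸ y))) ≗₂ ((A ^ᴾ y) ⊛ A)
  upper = ≗₂-trans (⊛-congʳ (A ^ᴾ suc y) (≡⇒≗₂ (cong (V ^ᴾ_) (ℕ.n∸n≡0 y))))
                   (≗₂-trans (⊛-identityʳ (A ^ᴾ suc y)) (⊛-comm A (A ^ᴾ y)))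

∑-transmutedTerm : ∀ m {n} (b : Vec ℕ n) → All (_≤ m) b → ∑ᴾ (box m n) (λ a → transmutedTerm a b) ≗₂ productFactor b
∑-transmutedTerm m []      []          i j = trans (ℤ.+-identityʳ _) (trans (ℤ.*-identityˡ _) (⊛-identityˡ onePS i j))
∑-transmutedTerm m {suc n} (y ∷ b) (y≤m ∷ b≤m) i j = begin
  ∑ (box m (suc n)) (λ a → transmutedTerm a (y ∷ b) i j)
    ≡⟨ ∑-box-suc m n _ ⟩
  sumUpTo m (λ x → ∑ (box m n) (λ a → transmutedTerm (x ∷ a) (y ∷ b) i j))
    ≡⟨ sumUpTo-cong m (λ x _ → trans (∑-cong (box m n) (λ a → transmutedTerm-∷ x y a b i j))
                                      (sym (∑ᴾ-⊛ˡ (box m n) (λ a → transmutedTerm a b) (chainTerm x y) i j))) ⟩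
  sumUpTo m (λ x → (chainTerm x y ⊛ S) i j)
    ≡⟨ ∑-applyUpTo (λ x → x) m (λ x → (chainTerm x y ⊛ S) i j) ⟨
  ∑ (List.upTo (suc m)) (λ x → (chainTerm x y ⊛ S) i j)
    ≡⟨ ∑ᴾ-⊛ʳ (List.upTo (suc m)) (λ x → chainTerm x y) S i j ⟨
  (∑ᴾ (List.upTo (suc m)) (λ x → chainTerm x y) ⊛ S) i j
    ≡⟨ ⊛-cong (∑-chainTerm m y y≤m) (∑-transmutedTerm m b b≤m) i j ⟩
  productFactor (y ∷ b) i j ∎
  where
  open ≡-Reasoning
  S : PS
  S = ∑ᴾ (box m n) (λ a → transmutedTerm a b)

-- The diagonal of the product factor

onePS-supported : Supported onePS 0 0 0
onePS-supported (suc i) j       _                     = refl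
onePS-supported zero    (suc j) _                     = refl
onePS-supported zero    zero    (inj₁ ())
onePS-supported zero    zero    (inj₂ (inj₁ ()))
onePS-supported zero    zero    (inj₂ (inj₂ ()))

oneMinusY-supported : Supported oneMinusY 0 0 1
oneMinusY-supported (suc i) j             _                       = refl
oneMinusY-supported zero    (suc (suc j)) _                       = refl
oneMinusY-supported zero    j             (inj₁ ())
oneMinusY-supported zero    j             (inj₂ (inj₁ ()))
oneMinusY-supported zero    zero          (inj₂ (inj₂ ()))
oneMinusY-supported zero    (suc zero)    (inj₂ (inj₂ (s≤s ())))

xyMinusY-supported : Supported xyMinusY 1 1 1
xyMinusY-supported (suc (suc i)) j             _                          = refl
xyMinusY-supported zero          zero          _                          = refl
xyMinusY-supported (suc zero)    zero          _                          = refl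
xyMinusY-supported zero          (suc (suc j)) _                          = refl
xyMinusY-supported (suc zero)    (suc (suc j)) _                          = refl
xyMinusY-supported zero          (suc zero)    (inj₁ ())
xyMinusY-supported zero          (suc zero)    (inj₂ (inj₁ (s≤s ())))
xyMinusY-supported zero          (suc zero)    (inj₂ (inj₂ (s≤s ())))
xyMinusY-supported (suc zero)    (suc zero)    (inj₁ (s≤s ()))
xyMinusY-supported (suc zero)    (suc zero)    (inj₂ (inj₁ (s≤s ())))
xyMinusY-supported (suc zero)    (suc zero)    (inj₂ (inj₂ (s≤s ())))

oneMinusY^ᴾ-supported : ∀ y → Supported (oneMinusY ^ᴾ y) 0 0 y
oneMinusY^ᴾ-supported zero    = onePS-supported
oneMinusY^ᴾ-supported (suc y) = ⊛-supported oneMinusY-supported (oneMinusY^ᴾ-supported y)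

oneMinusY^ᴾ-corner : ∀ y → (oneMinusY ^ᴾ y) 0 0 ≡ 1ℤ
oneMinusY^ᴾ-corner zero    = refl
oneMinusY^ᴾ-corner (suc y) =
  trans (⊛-corner oneMinusY-supported (oneMinusY^ᴾ-supported y)) (cong (1ℤ *_) (oneMinusY^ᴾ-corner y))

chainFactor-suc-supported : ∀ y → Supported (chainFactor (suc y)) 1 1 (suc y)
chainFactor-suc-supported y =
  Supported-≡ refl refl (ℕ.+-comm y 1) (⊛-supported (oneMinusY^ᴾ-supported y) xyMinusY-supported)

productFactor-supported : ∀ {n} (b : Vec ℕ n) → Supported (productFactor b) (nz b) (nz b) (ht b)
productFactor-supported []          = onePS-supported
productFactor-supported (zero  ∷ b) = ⊛-supported onePS-supported (productFactor-supported b)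
productFactor-supported (suc y ∷ b) = ⊛-supported (chainFactor-suc-supported y) (productFactor-supported b)

productFactor-corner : ∀ {n} (b : Vec ℕ n) → productFactor b (nz b) (nz b) ≡ 1ℤ
productFactor-corner []          = refl
productFactor-corner (zero ∷ b)  =
  trans (⊛-corner onePS-supported (productFactor-supported b)) (cong (1ℤ *_) (productFactor-corner b))
productFactor-corner (suc y ∷ b) =
  trans (⊛-corner (chainFactor-suc-supported y) (productFactor-supported b))
        (cong₂ _*_ chainFactor-corner (productFactor-corner b))
  where
  chainFactor-corner : chainFactor (suc y) 1 1 ≡ 1ℤ
  chainFactor-corner =
    trans (⊛-corner (oneMinusY^ᴾ-supported y) xyMinusY-supported) (cong (_* 1ℤ) (oneMinusY^ᴾ-corner y))

productFactor-diagonal : ∀ {n} (b : Vec ℕ n) k → productFactor b k k ≡ [ nz b ℕ.≡ᵇ k ]· 1ℤ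
productFactor-diagonal b k with ℕ.<-cmp k (nz b)
... | tri< k<nz k≢nz _ = trans (productFactor-supported b k k (inj₂ (inj₁ k<nz)))
                               (sym ([]·-¬T 1ℤ (k≢nz ∘ sym ∘ ℕ.≡ᵇ⇒≡ (nz b) k)))
... | tri> _ k≢nz nz<k = trans (productFactor-supported b k k (inj₁ nz<k))
                               (sym ([]·-¬T 1ℤ (k≢nz ∘ sym ∘ ℕ.≡ᵇ⇒≡ (nz b) k)))
... | tri≈ _ refl _    = trans (productFactor-corner b) (sym ([]·-T 1ℤ (ℕ.≡⇒≡ᵇ (nz b) (nz b) refl)))

∑-filterᵇ-box-cong : ∀ m n (P : Vec ℕ n → Bool) {f g : Vec ℕ n → ℤ} →
  (∀ b → T (P b) → All (_≤ m) b → f b ≡ g b) → ∑ (filterᵇ P (box m n)) f ≡ ∑ (filterᵇ P (box m n)) g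
∑-filterᵇ-box-cong m n P f≗g =
  trans (∑-filterᵇ P (box m n) _)
        (trans (∑-box-cong m n (λ b b≤m → []·-cong (P b) (λ Pb → f≗g b Pb b≤m))) (sym (∑-filterᵇ P (box m n) _)))

allᵇ-mono : ∀ {X : Set} (p q : X → Bool) xs → (∀ x → T (p x) → T (q x)) → T (allᵇ p xs) → T (allᵇ q xs)
allᵇ-mono p q []       p⇒q _   = _
allᵇ-mono p q (x ∷ xs) p⇒q all with T-∧⁻ {p x} all
... | px , pxs = T-∧⁺ (p⇒q x px) (allᵇ-mono p q xs p⇒q pxs)

sumOver-mono : ∀ {n} (c b : Vec ℕ n) → T (c ≤ⱽ b) → ∀ D → sumOver c D ≤ sumOver b D
sumOver-mono c b c≤b []      = z≤n
sumOver-mono c b c≤b (k ∷ D) = ℕ.+-mono-≤ (≤ⱽ⇒lookup≤ c b c≤b k) (sumOver-mono c b c≤b D)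

inPᵇ-down : ∀ {n} (t : Tree (List (Fin n))) c b → T (c ≤ⱽ b) → T (inPᵇ t b) → T (inPᵇ t c)
inPᵇ-down t c b c≤b = allᵇ-mono _ _ (downsets t)
  (λ D b∈ → ℕ.≤⇒≤ᵇ (ℕ.≤-trans (sumOver-mono c b c≤b D) (ℕ.≤ᵇ⇒≤ _ _ b∈)))

countᵇ≤length-filterᵇ : ∀ {X : Set} (q p : X → Bool) xs → (∀ x → T (q x) → T (p x)) →
                        countᵇ q xs ≤ List.length (filterᵇ p xs)
countᵇ≤length-filterᵇ q p []       q⇒p = z≤n
countᵇ≤length-filterᵇ q p (x ∷ xs) q⇒p with q x | p x | q⇒p x
... | true  | true  | _   = s≤s (countᵇ≤length-filterᵇ q p xs q⇒p)
... | true  | false | q⇒p′ = contradiction (q⇒p′ _) (λ ())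
... | false | true  | _   = ℕ.m≤n⇒m≤1+n (countᵇ≤length-filterᵇ q p xs q⇒p)
... | false | false | _   = countᵇ≤length-filterᵇ q p xs q⇒p

ht≤n*m : ∀ {m n} (b : Vec ℕ n) → All (_≤ m) b → ht b ≤ n ℕ.* m
ht≤n*m []      []          = z≤n
ht≤n*m (y ∷ b) (y≤m ∷ b≤m) = ℕ.+-mono-≤ y≤m (ht≤n*m b b≤m)

nz≤n : ∀ {n} (b : Vec ℕ n) → nz b ≤ n
nz≤n []          = z≤n
nz≤n (zero  ∷ b) = ℕ.m≤n⇒m≤1+n (nz≤n b)
nz≤n (suc _ ∷ b) = s≤s (nz≤n b)

-- Abstracted over the folding function: the pattern lambda inside Mbar is only accessible through its β-rule.
foldr-∑ : (F : ℤ × ℕ × ℕ → PS → PS) → (∀ c p q acc i j → F (c , p , q) acc i j ≡ c * substMono p q i j + acc i j) →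
          ∀ xs i j → List.foldr F zeroPS xs i j ≡ ∑ xs (λ (c , p , q) → c * substMono p q i j)
foldr-∑ F F-β []                  i j = refl
foldr-∑ F F-β ((c , p , q) ∷ xs) i j = trans (F-β c p q _ i j) (cong (λ s → c * substMono p q i j + s) (foldr-∑ F F-β xs i j))

module Transmuted (n : ℕ) (t : Tree (List (Fin n))) where

  P : Vec ℕ n → Bool
  P = inPᵇ t

  open LowerSet n n P (inPᵇ-down t)

  ht≤length-Pt : ∀ b → T (P b) → All (_≤ n) b → ht b ≤ List.length (Pt t)
  ht≤length-Pt b Pb b≤n = begin
    ht b                                          <⟨ ht<boxVolume b ⟩
    boxVolume b                                   ≡⟨ ℤ.+-injective (trans (sym (∑-box-≤ⱽ n n b b≤n)) (∑-countᵇ _ (box n n))) ⟩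
    countᵇ (λ c → c ≤ⱽ b) (box n n)               ≤⟨ countᵇ≤length-filterᵇ _ P (box n n) (λ c c≤b → inPᵇ-down t c b c≤b Pb) ⟩
    List.length (Pt t)                            ∎
    where open ℕ.≤-Reasoning

  μ≡μⱽ : ∀ a b → T (P b) → All (_≤ n) b → μ t a b ≡ μⱽ a b
  μ≡μⱽ a b Pb b≤n =
    mobiusF-lowerSet (List.length (Pt t)) a b Pb b≤n (ℕ.≤-trans (ℕ.m∸n≤m (ht b) (ht a)) (ht≤length-Pt b Pb b≤n))

  contribution : ∀ b → T (P b) → All (_≤ n) b → ∀ i j →
    ∑ (Pt t) (λ a → [ a ≤ⱽ b ]· (μ t a b * substMono (ht a) (ht b) i j)) ≡ productFactor b i j
  contribution b Pb b≤n i j = begin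
    ∑ (Pt t) (λ a → [ a ≤ⱽ b ]· (μ t a b * substMono (ht a) (ht b) i j))
      ≡⟨ ∑-filterᵇ P (box n n) _ ⟩
    ∑ (box n n) (λ a → [ P a ]· [ a ≤ⱽ b ]· (μ t a b * substMono (ht a) (ht b) i j))
      ≡⟨ ∑-cong (box n n) term ⟩
    ∑ (box n n) (λ a → transmutedTerm a b i j)
      ≡⟨ ∑-transmutedTerm n b b≤n i j ⟩
    productFactor b i j ∎
    where
    open ≡-Reasoning
    term : ∀ a → [ P a ]· [ a ≤ⱽ b ]· (μ t a b * substMono (ht a) (ht b) i j) ≡ transmutedTerm a b i j
    term a with T? (a ≤ⱽ b)
    ... | yes a≤b = trans ([]·-T _ (inPᵇ-down t a b a≤b Pb)) (trans ([]·-T _ a≤b)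
                      (cong₂ _*_ (μ≡μⱽ a b Pb b≤n) (substMono-≤ (ht a) (ht b) (≤ⱽ⇒ht≤ a b a≤b) i j)))
    ... | no  a≰b = trans (cong [ P a ]·_ ([]·-¬T _ a≰b))
                      (trans ([]·-zero (P a)) (sym (i≡0⇒i*j≡0 _ (μⱽ-≰ a b a≰b))))

  Mbar≡∑productFactor : ∀ i j → Mbar t i j ≡ ∑ (Pt t) (λ b → productFactor b i j)
  Mbar≡∑productFactor i j = begin
    Mbar t i j
      ≡⟨ foldr-∑ _ (λ _ _ _ _ _ _ → refl) (Mterms t) i j ⟩
    ∑ (Mterms t) (λ (c , p , q) → c * substMono p q i j)
      ≡⟨ ∑-concatMap (Pt t) _ _ ⟩
    ∑ (Pt t) (λ a → ∑ (List.map (λ b → (μ t a b , ht a , ht b)) (filterᵇ (a ≤ⱽ_) (Pt t))) (λ (c , p , q) → c * substMono p q i j))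
      ≡⟨ ∑-cong (Pt t) (λ a → trans (∑-map (filterᵇ (a ≤ⱽ_) (Pt t)) _ _) (∑-filterᵇ (a ≤ⱽ_) (Pt t) _)) ⟩
    ∑ (Pt t) (λ a → ∑ (Pt t) (λ b → [ a ≤ⱽ b ]· (μ t a b * substMono (ht a) (ht b) i j)))
      ≡⟨ ∑-swap (Pt t) (Pt t) _ ⟩
    ∑ (Pt t) (λ b → ∑ (Pt t) (λ a → [ a ≤ⱽ b ]· (μ t a b * substMono (ht a) (ht b) i j)))
      ≡⟨ ∑-filterᵇ-box-cong n n P (λ b Pb b≤n → contribution b Pb b≤n i j) ⟩
    ∑ (Pt t) (λ b → productFactor b i j) ∎
    where open ≡-Reasoning

proposition4p1 : (n : ℕ) (t : Tree (List (Fin n))) → IsArbor n t →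
    (Σ ℕ (λ D → (i j : ℕ) → (D < i ⊎ D < j) → Mbar t i j ≡ 0ℤ))
    × ((k : ℕ) → Mbar t k k ≡ + (hcoeff t k))
proposition4p1 n t _ = (n ℕ.* n ℕ.+ n , vanishes) , diagonal
  where
  open Transmuted n t

  outside : ∀ {i j} (b : Vec ℕ n) → All (_≤ n) b → n ℕ.* n ℕ.+ n < i ⊎ n ℕ.* n ℕ.+ n < j → Outside (nz b) (nz b) (ht b) i j
  outside b _   (inj₁ D<i) = inj₁ (ℕ.≤-<-trans (ℕ.≤-trans (nz≤n b) (ℕ.m≤n+m n (n ℕ.* n))) D<i)
  outside b b≤n (inj₂ D<j) = inj₂ (inj₂ (ℕ.≤-<-trans (ℕ.≤-trans (ht≤n*m b b≤n) (ℕ.m≤m+n (n ℕ.* n) n)) D<j))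

  vanishes : (i j : ℕ) → n ℕ.* n ℕ.+ n < i ⊎ n ℕ.* n ℕ.+ n < j → Mbar t i j ≡ 0ℤ
  vanishes i j out = begin
    Mbar t i j                                ≡⟨ Mbar≡∑productFactor i j ⟩
    ∑ (Pt t) (λ b → productFactor b i j)      ≡⟨ ∑-filterᵇ-box-cong n n P (λ b _ b≤n → productFactor-supported b i j (outside b b≤n out)) ⟩
    ∑ (Pt t) (λ _ → 0ℤ)                       ≡⟨ ∑-zero (Pt t) (λ _ → refl) ⟩
    0ℤ                                        ∎
    where open ≡-Reasoning

  diagonal : (k : ℕ) → Mbar t k k ≡ + hcoeff t k
  diagonal k = begin
    Mbar t k k                                ≡⟨ Mbar≡∑productFactor k k ⟩
    ∑ (Pt t) (λ b → productFactor b k k)      ≡⟨ ∑-cong (Pt t) (λ b → productFactor-diagonal b k) ⟩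
    ∑ (Pt t) (λ b → [ nz b ℕ.≡ᵇ k ]· 1ℤ)      ≡⟨ ∑-countᵇ (λ b → nz b ℕ.≡ᵇ k) (Pt t) ⟩
    + hcoeff t k                              ∎
    where open ≡-Reasoning
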